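{- For a partition $\nu=(\nu_1,\ldots,\nu_l)$ with $g(\nu)=\gcd(\nu_1,\dots,\nu_l)$ and $G_\nu(t)=\big(tA_{l-1}(t)\prod_{i=1}^l[\nu_i]_t\big)_{g(\nu)}$, we have \[ G_\nu(t)=\sum_{d\mid g(\nu)}\mu(d)\,d^{l-1}\,t^dA_{l-1}(t^d)\prod_{i=1}^l\Big[\frac{\nu_i}{d}\Big]_{t^d}, \] where $\mu$ is the classical Möbius function.
   Context: $A_m(t)=\sum_{\sigma\in S_m}t^{{\rm exc}(\sigma)}$ is the Eulerian polynomial for $m\ge1$, where ${\rm exc}(\sigma)=|\{i\in[m-1]:i\sigma>i\}|$, and $A_0(t)=1$. $[m]_q=1+q+\cdots+q^{m-1}$. For a power series $f(t)=\sum_ja_jt^j$ and a positive integer $k$, $f(t)_k=\sum_{j:\gcd(j,k)=1}a_jt^j$ (with $\gcd(0,k)=k$). -}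

module Defs where

open import Data.Nat as ℕ using (ℕ; zero; suc; _≥_; _>_; _≤_)
open import Data.Nat.GCD using (gcd)
open import Data.Nat.Divisibility using (_∣_; _∣?_)
open import Data.Nat.Primality using (Prime; prime?)
open import Data.Integer as ℤ using (ℤ; +_)
open import Data.List as List using (List; []; _∷_; concatMap; filter; length; upTo; map)
open import Data.Vec as Vec using (Vec)
open import Data.Bool using (if_then_else_)
open import Relation.Nullary.Decidable using (does; _×-dec_)
open import Relation.Binary.PropositionalEquality using (_≡_)

-- Formal power series with integer coefficients, as coefficient functions.
Series : Set
Series = ℕ → ℤ

sumBelow : ℕ → (ℕ → ℤ) → ℤ
sumBelow zero    f = + 0
sumBelow (suc n) f = sumBelow n f ℤ.+ f n

_⊛_ : Series → Series → Series
(f ⊛ g) n = sumBelow (suc n) (λ i → f i ℤ.* g (n ℕ.∸ i))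

one : Series
one zero    = + 1
one (suc _) = + 0

tSer : Series
tSer 1 = + 1
tSer _ = + 0

scale : ℤ → Series → Series
scale c f n = c ℤ.* f n

qInt : ℕ → Series
qInt m n = if does (suc n ℕ.≤? m) then + 1 else + 0

-- f(t^d): coefficient of t^n is f_j if n = d*j, else 0
substPow : ℕ → Series → Series
substPow d f n = sumBelow (suc n) (λ j → if does (d ℕ.* j ℕ.≟ n) then f j else + 0)

-- f(t)_k : keep only coefficients a_j with gcd(j,k) = 1 (gcd 0 k = k)
coprimePart : ℕ → Series → Series
coprimePart k f j = if does (gcd j k ℕ.≟ 1) then f j else + 0

prodVec : ∀ {n} → Vec Series n → Series
prodVec = Vec.foldr _ _⊛_ one

insertions : ℕ → List ℕ → List (List ℕ)
insertions x []       = (x ∷ []) ∷ []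
insertions x (y ∷ ys) = (x ∷ y ∷ ys) ∷ map (y ∷_) (insertions x ys)

perms : List ℕ → List (List ℕ)
perms []       = [] ∷ []
perms (x ∷ xs) = concatMap (insertions x) (perms xs)

-- S_m as the list of words w = (1σ, ..., mσ) that are permutations of 1..m
Sym : ℕ → List (List ℕ)
Sym m = perms (map suc (upTo m))

-- exc(w) = #{ i : w_i > i }, positions counted from i
excFrom : ℕ → List ℕ → ℕ
excFrom i []       = 0
excFrom i (w ∷ ws) = (if does (w ℕ.>? i) then 1 else 0) ℕ.+ excFrom (suc i) ws

exc : List ℕ → ℕ
exc = excFrom 1

-- Eulerian polynomial A_m(t) = Σ_{σ ∈ S_m} t^{exc σ}  (A_0 = 1 automatically)
eulerian : ℕ → Series
eulerian m j = + length (filter (λ w → exc w ℕ.≟ j) (Sym m))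

-- Möbius function (for n ≥ 1): 0 if some prime square divides n,
-- otherwise (-1)^(number of distinct prime divisors)
numPrimeDivs : ℕ → ℕ
numPrimeDivs n = length (filter (λ p → prime? p ×-dec (p ∣? n)) (upTo (suc n)))

squareFree? : ℕ → List ℕ
squareFree? n = filter (λ p → prime? p ×-dec ((p ℕ.* p) ∣? n)) (upTo (suc n))

mobius : ℕ → ℤ
mobius n with squareFree? n
... | []    = (ℤ.- (+ 1)) ℤ.^ numPrimeDivs n
... | _ ∷ _ = + 0

gcdVec : ∀ {n} → Vec ℕ n → ℕ
gcdVec = Vec.foldr _ gcd 0

data Partition : ∀ {n} → Vec ℕ n → Set where
  single : ∀ {a} → a ≥ 1 → Partition (a Vec.∷ Vec.[])
  cons   : ∀ {n a b} {v : Vec ℕ n} → a ≥ b → Partition (b Vec.∷ v) → Partition (a Vec.∷ b Vec.∷ v)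

-- G_ν(t) = ( t A_{l-1}(t) Π [ν_i]_t )_{g(ν)}, for ν with l = suc k parts
G : ∀ {k} → Vec ℕ (suc k) → Series
G {k} ν = coprimePart (gcdVec ν) (tSer ⊛ (eulerian k ⊛ prodVec (Vec.map qInt ν)))

-- Σ_{d ∣ g, 1 ≤ d ≤ g} F d ; the summand receives e with d = suc e (so d ≠ 0)
sumDivisors : ℕ → (ℕ → Series) → Series
sumDivisors g F n = sumBelow g (λ e → if does (suc e ∣? g) then F e n else + 0)

RHS : ∀ {k} → Vec ℕ (suc k) → Series
RHS {k} ν = sumDivisors (gcdVec ν) (λ e →
  scale (mobius (suc e) ℤ.* (+ suc e) ℤ.^ k)
    (substPow (suc e) (tSer ⊛ (eulerian k ⊛ prodVec (Vec.map (λ a → qInt (a ℕ./ suc e)) ν)))))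

module Submission where

-- Write l = k + 1 and F_ν(t) = t A_k(t) Π_i [ν_i]_t.  The argument has three ingredients.
--  (1) Worpitzky's identity  A_k(t) = (1-t)^{k+1} Σ_{n≥0} (n+1)^k t^n.  It is proved for a
--      more general "staircase" of excedance thresholds, by inserting the smallest letter
--      into the permutations of the remaining ones; the general form makes the induction go
--      through.  Since (1-t)[a]_t = 1 - t^a, this gives the explicit coefficient formula
--          F_ν(t) = Π_i (1 - t^{ν_i}) Σ_{n≥1} n^k t^n.
--  (2) Dilation: if d divides every ν_i, the formula in (1) shows that the coefficient of
--      t^{dm} in F_ν is d^k times the coefficient of t^m in F_{ν/d}; so the d-th summand of
--      the right hand side is μ(d) F_ν(t) restricted to exponents divisible by d.
--  (3) The Möbius identity  Σ_{d ∣ h} μ(d) = [h = 1], proved from the definition of μ by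
--      splitting the divisors of h according to divisibility by a prime factor of h.
-- Summing (2) over d ∣ g and applying (3) to h = gcd(n, g) keeps exactly the coefficients
-- of F_ν at exponents n coprime to g, which is G_ν.

open import Defs
open import Data.Nat using (ℕ; suc)
open import Data.Vec using (Vec)
open import Relation.Binary.PropositionalEquality using (_≡_)

open import Data.Nat as ℕ using (zero; _∸_; _≤_; _<_; z≤n; s≤s)
import Data.Nat.Properties as ℕP
import Data.Nat.Tactic.RingSolver as ℕSolver
open import Data.Nat.Divisibility
open import Data.Nat.DivMod using (_/_; m*[n/m]≡n; m/n≤m)
open import Data.Nat.GCD using (gcd; gcd[m,n]∣m; gcd[m,n]∣n; gcd-greatest; gcd[m,n]≡0⇒m≡0; gcd[m,n]≡0⇒n≡0)
open import Data.Nat.Coprimality using (Coprime; coprime-divisor)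
open import Data.Nat.Primality using (Prime; prime?; euclidsLemma; prime⇒irreducible; prime⇒nonZero; prime⇒nonTrivial)
open import Data.Nat.Primality.Factorisation using (factorise; PrimeFactorisation)
open import Data.Nat.ListAction using (product)
open import Data.Integer as ℤ using (ℤ; +_; _+_; _-_; _*_; -_)
import Data.Integer.Properties as ℤP
open import Data.Integer.Tactic.RingSolver using (solve-∀)
open import Data.Bool using (Bool; true; false; if_then_else_)
open import Data.Empty using (⊥-elim)
open import Data.Unit using (⊤; tt)
open import Data.Product using (Σ; _×_; _,_; proj₁; proj₂)
open import Data.Sum using (inj₁; inj₂)
open import Data.List as List using (List; []; _∷_; _++_; map; length; filter; upTo; concatMap; applyUpTo)
import Data.List.Properties as ListP
open import Data.List.Relation.Unary.All as ListAll using ([]; _∷_)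
import Data.List.Relation.Unary.All.Properties as ListAllP
import Data.Vec as Vec
open import Data.Vec.Relation.Unary.All as VecAll using ([]; _∷_)
import Data.Vec.Properties as VecP
open import Function using (_∘_)
open import Relation.Binary.PropositionalEquality using (refl; sym; trans; cong; cong₂; subst; subst₂; _≢_; _≗_; module ≡-Reasoning)
open import Relation.Nullary using (¬_; Dec; yes; no)
open import Relation.Nullary.Decidable using (does; _×-dec_; dec-true; dec-false)
open import Relation.Unary using (Decidable)

if-yes : ∀ {A B : Set} (d : Dec A) {x y : B} → A → (if does d then x else y) ≡ x
if-yes d a rewrite dec-true d a = refl

if-no : ∀ {A B : Set} (d : Dec A) {x y : B} → ¬ A → (if does d then x else y) ≡ y
if-no d ¬a rewrite dec-false d ¬a = refl

does-⇔ : ∀ {A B : Set} → (A → B) → (B → A) → (da : Dec A) (db : Dec B) → does da ≡ does db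
does-⇔ f g (yes a) (yes b) = refl
does-⇔ f g (yes a) (no ¬b) = ⊥-elim (¬b (f a))
does-⇔ f g (no ¬a) (yes b) = ⊥-elim (¬a (g b))
does-⇔ f g (no _)  (no _)  = refl

sum-cong : ∀ n {f g : ℕ → ℤ} → (∀ i → i < n → f i ≡ g i) → sumBelow n f ≡ sumBelow n g
sum-cong zero    eq = refl
sum-cong (suc n) eq = cong₂ _+_ (sum-cong n (λ i i<n → eq i (ℕP.m<n⇒m<1+n i<n))) (eq n ℕP.≤-refl)

sum-zero : ∀ n → sumBelow n (λ _ → + 0) ≡ + 0
sum-zero zero    = refl
sum-zero (suc n) rewrite sum-zero n = refl

sum-+ : ∀ n (f g : ℕ → ℤ) → sumBelow n (λ i → f i + g i) ≡ sumBelow n f + sumBelow n g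
sum-+ zero    f g = refl
sum-+ (suc n) f g rewrite sum-+ n f g = interchange (sumBelow n f) (sumBelow n g) (f n) (g n)
  where
  interchange : ∀ a b c d → a + b + (c + d) ≡ a + c + (b + d)
  interchange = solve-∀

sum-- : ∀ n (f g : ℕ → ℤ) → sumBelow n (λ i → f i - g i) ≡ sumBelow n f - sumBelow n g
sum-- zero    f g = refl
sum-- (suc n) f g rewrite sum-- n f g = interchange (sumBelow n f) (sumBelow n g) (f n) (g n)
  where
  interchange : ∀ a b c d → a - b + (c - d) ≡ a + c - (b + d)
  interchange = solve-∀

sum-neg : ∀ n (f : ℕ → ℤ) → sumBelow n (λ i → - f i) ≡ - sumBelow n f
sum-neg zero    f = refl
sum-neg (suc n) f rewrite sum-neg n f = sym (ℤP.neg-distrib-+ (sumBelow n f) (f n))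

sum-*ʳ : ∀ n (f : ℕ → ℤ) c → sumBelow n (λ i → f i * c) ≡ sumBelow n f * c
sum-*ʳ zero    f c = sym (ℤP.*-zeroˡ c)
sum-*ʳ (suc n) f c rewrite sum-*ʳ n f c = sym (ℤP.*-distribʳ-+ c (sumBelow n f) (f n))

sum-first : ∀ n (f : ℕ → ℤ) → sumBelow (suc n) f ≡ f 0 + sumBelow n (f ∘ suc)
sum-first zero    f = ℤP.+-comm (+ 0) (f 0)
sum-first (suc n) f rewrite sum-first n f = ℤP.+-assoc (f 0) _ _

sum-split : ∀ a b (f : ℕ → ℤ) → sumBelow (a ℕ.+ b) f ≡ sumBelow a f + sumBelow b (λ r → f (a ℕ.+ r))
sum-split a zero    f rewrite ℕP.+-identityʳ a = sym (ℤP.+-identityʳ _)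
sum-split a (suc b) f rewrite ℕP.+-suc a b | sum-split a b f = ℤP.+-assoc (sumBelow a f) _ _

sum-blocks : ∀ p j (f : ℕ → ℤ) → sumBelow (j ℕ.* p) f ≡ sumBelow j (λ i → sumBelow p (λ r → f (i ℕ.* p ℕ.+ r)))
sum-blocks p zero    f = refl
sum-blocks p (suc j) f = begin
    sumBelow (p ℕ.+ j ℕ.* p) f
  ≡⟨ cong (λ z → sumBelow z f) (ℕP.+-comm p (j ℕ.* p)) ⟩
    sumBelow (j ℕ.* p ℕ.+ p) f
  ≡⟨ sum-split (j ℕ.* p) p f ⟩
    sumBelow (j ℕ.* p) f + sumBelow p (λ r → f (j ℕ.* p ℕ.+ r))
  ≡⟨ cong (_+ sumBelow p (λ r → f (j ℕ.* p ℕ.+ r))) (sum-blocks p j f) ⟩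
    sumBelow (suc j) (λ i → sumBelow p (λ r → f (i ℕ.* p ℕ.+ r))) ∎
  where open ≡-Reasoning

sum-truncate : ∀ M N (f : ℕ → ℤ) → M ≤ N → (∀ e → M ≤ e → f e ≡ + 0) → sumBelow N f ≡ sumBelow M f
sum-truncate M N f M≤N vanish = begin
    sumBelow N f
  ≡⟨ cong (λ z → sumBelow z f) (sym (ℕP.m+[n∸m]≡n M≤N)) ⟩
    sumBelow (M ℕ.+ (N ∸ M)) f
  ≡⟨ sum-split M (N ∸ M) f ⟩
    sumBelow M f + sumBelow (N ∸ M) (λ r → f (M ℕ.+ r))
  ≡⟨ cong (λ z → sumBelow M f + z) (trans (sum-cong (N ∸ M) (λ r _ → vanish (M ℕ.+ r) (ℕP.m≤m+n M r))) (sum-zero (N ∸ M))) ⟩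
    sumBelow M f + + 0
  ≡⟨ ℤP.+-identityʳ _ ⟩
    sumBelow M f ∎
  where open ≡-Reasoning

sum-single : ∀ N (f : ℕ → ℤ) c → (∀ j → j < N → j ≢ c → f j ≡ + 0) → c < N → sumBelow N f ≡ f c
sum-single (suc N) f c vanish c<N with N ℕP.≟ c
... | yes refl = trans (cong (_+ f N) (trans (sum-cong N (λ j j<N → vanish j (ℕP.m<n⇒m<1+n j<N) (ℕP.<⇒≢ j<N))) (sum-zero N)))
                       (ℤP.+-identityˡ _)
... | no N≢c = trans (cong₂ _+_ (sum-single N f c (λ j j<N → vanish j (ℕP.m<n⇒m<1+n j<N)) c<N′) (vanish N ℕP.≤-refl N≢c))
                     (ℤP.+-identityʳ _)
  where
  c<N′ : c < N
  c<N′ = ℕP.≤∧≢⇒< (ℕP.≤-pred c<N) (λ e → N≢c (sym e))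

shift : Series → Series
shift f zero    = + 0
shift f (suc n) = f n

shiftBy : ℕ → Series → Series
shiftBy zero    f = f
shiftBy (suc a) f = shift (shiftBy a f)

_⊖_ : Series → Series → Series
(f ⊖ g) n = f n - g n

-- Multiplication by (1 - t) and by (1 - t)^j.
Δ : Series → Series
Δ f = f ⊖ shift f

Δ^ : ℕ → Series → Series
Δ^ zero    f = f
Δ^ (suc j) f = Δ (Δ^ j f)

shift-cong : ∀ {f g} → f ≗ g → shift f ≗ shift g
shift-cong eq zero    = refl
shift-cong eq (suc n) = eq n

shiftBy-cong : ∀ a {f g} → f ≗ g → shiftBy a f ≗ shiftBy a g
shiftBy-cong zero    eq = eq
shiftBy-cong (suc a) eq = shift-cong (shiftBy-cong a eq)

⊖-cong : ∀ {f f′ g g′} → f ≗ f′ → g ≗ g′ → f ⊖ g ≗ f′ ⊖ g′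
⊖-cong eq₁ eq₂ n = cong₂ _-_ (eq₁ n) (eq₂ n)

Δ-cong : ∀ {f g} → f ≗ g → Δ f ≗ Δ g
Δ-cong eq = ⊖-cong eq (shift-cong eq)

Δ^-cong : ∀ j {f g} → f ≗ g → Δ^ j f ≗ Δ^ j g
Δ^-cong zero    eq = eq
Δ^-cong (suc j) eq = Δ-cong (Δ^-cong j eq)

Δ^-Δ : ∀ j f → Δ^ j (Δ f) ≗ Δ (Δ^ j f)
Δ^-Δ zero    f n = refl
Δ^-Δ (suc j) f   = Δ-cong (Δ^-Δ j f)

shiftBy-+ : ∀ a f n → shiftBy a f (a ℕ.+ n) ≡ f n
shiftBy-+ zero    f n = refl
shiftBy-+ (suc a) f n = shiftBy-+ a f n

shiftBy-< : ∀ a f n → n < a → shiftBy a f n ≡ + 0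
shiftBy-< (suc a) f zero    _           = refl
shiftBy-< (suc a) f (suc n) (s≤s n<a) = shiftBy-< a f n n<a

shiftBy-+ˢ : ∀ b (f g : Series) n → shiftBy b (λ m → f m + g m) n ≡ shiftBy b f n + shiftBy b g n
shiftBy-+ˢ zero    f g n       = refl
shiftBy-+ˢ (suc b) f g zero    = refl
shiftBy-+ˢ (suc b) f g (suc n) = shiftBy-+ˢ b f g n

shiftBy-⊖ : ∀ b (f g : Series) n → shiftBy b (f ⊖ g) n ≡ shiftBy b f n - shiftBy b g n
shiftBy-⊖ zero    f g n       = refl
shiftBy-⊖ (suc b) f g zero    = refl
shiftBy-⊖ (suc b) f g (suc n) = shiftBy-⊖ b f g n

shiftBy-zero : ∀ b n → shiftBy b (λ _ → + 0) n ≡ + 0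
shiftBy-zero zero    n       = refl
shiftBy-zero (suc b) zero    = refl
shiftBy-zero (suc b) (suc n) = shiftBy-zero b n

shiftBy-shiftBy : ∀ a b f → shiftBy a (shiftBy b f) ≗ shiftBy (a ℕ.+ b) f
shiftBy-shiftBy zero    b f n = refl
shiftBy-shiftBy (suc a) b f   = shift-cong (shiftBy-shiftBy a b f)

shiftBy-comm : ∀ a b f n → shiftBy a (shiftBy b f) n ≡ shiftBy b (shiftBy a f) n
shiftBy-comm a b f n = begin
    shiftBy a (shiftBy b f) n  ≡⟨ shiftBy-shiftBy a b f n ⟩
    shiftBy (a ℕ.+ b) f n      ≡⟨ cong (λ z → shiftBy z f n) (ℕP.+-comm a b) ⟩
    shiftBy (b ℕ.+ a) f n      ≡⟨ sym (shiftBy-shiftBy b a f n) ⟩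
    shiftBy b (shiftBy a f) n  ∎
  where open ≡-Reasoning

⊛-congˡ : ∀ {f f′} g → f ≗ f′ → f ⊛ g ≗ f′ ⊛ g
⊛-congˡ g eq n = sum-cong (suc n) (λ i _ → cong (_* g (n ∸ i)) (eq i))

⊛-congʳ : ∀ f {g g′} → g ≗ g′ → f ⊛ g ≗ f ⊛ g′
⊛-congʳ f eq n = sum-cong (suc n) (λ i _ → cong (f i *_) (eq (n ∸ i)))

⊛-identityˡ : ∀ f → one ⊛ f ≗ f
⊛-identityˡ f n = begin
    sumBelow (suc n) (λ i → one i * f (n ∸ i))
  ≡⟨ sum-first n _ ⟩
    one 0 * f n + sumBelow n (λ i → one (suc i) * f (n ∸ suc i))
  ≡⟨ cong₂ _+_ (ℤP.*-identityˡ (f n)) (trans (sum-cong n (λ i _ → ℤP.*-zeroˡ (f (n ∸ suc i)))) (sum-zero n)) ⟩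
    f n + + 0
  ≡⟨ ℤP.+-identityʳ (f n) ⟩
    f n ∎
  where open ≡-Reasoning

⊛-identityʳ : ∀ f → f ⊛ one ≗ f
⊛-identityʳ f n = begin
    sumBelow n (λ i → f i * one (n ∸ i)) + f n * one (n ∸ n)
  ≡⟨ cong₂ _+_ (trans (sum-cong n earlier) (sum-zero n)) (cong (λ m → f n * one m) (ℕP.n∸n≡0 n)) ⟩
    + 0 + f n * + 1
  ≡⟨ trans (ℤP.+-identityˡ _) (ℤP.*-identityʳ (f n)) ⟩
    f n ∎
  where
  open ≡-Reasoning
  earlier : ∀ i → i < n → f i * one (n ∸ i) ≡ + 0
  earlier i i<n = trans (cong (λ m → f i * one m) (ℕP.+-∸-assoc 1 i<n)) (ℤP.*-zeroʳ (f i))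

⊛-shiftˡ : ∀ f g → shift f ⊛ g ≗ shift (f ⊛ g)
⊛-shiftˡ f g zero    = ℤP.*-zeroˡ (g 0)
⊛-shiftˡ f g (suc n) = begin
    sumBelow (suc (suc n)) (λ i → shift f i * g (suc n ∸ i))
  ≡⟨ sum-first (suc n) _ ⟩
    + 0 * g (suc n) + sumBelow (suc n) (λ i → f i * g (n ∸ i))
  ≡⟨ cong (_+ sumBelow (suc n) (λ i → f i * g (n ∸ i))) (ℤP.*-zeroˡ (g (suc n))) ⟩
    + 0 + sumBelow (suc n) (λ i → f i * g (n ∸ i))
  ≡⟨ ℤP.+-identityˡ _ ⟩
    (f ⊛ g) n ∎
  where open ≡-Reasoning

⊛-shiftʳ : ∀ f g → f ⊛ shift g ≗ shift (f ⊛ g)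
⊛-shiftʳ f g zero    = cong (λ z → + 0 + z) (ℤP.*-zeroʳ (f 0))
⊛-shiftʳ f g (suc n) = begin
    sumBelow (suc n) (λ i → f i * shift g (suc n ∸ i)) + f (suc n) * shift g (suc n ∸ suc n)
  ≡⟨ cong₂ _+_ (sum-cong (suc n) (λ i i≤n → cong (λ m → f i * shift g m) (ℕP.+-∸-assoc 1 (ℕP.≤-pred i≤n))))
               (trans (cong (λ m → f (suc n) * shift g m) (ℕP.n∸n≡0 n)) (ℤP.*-zeroʳ (f (suc n)))) ⟩
    (f ⊛ g) n + + 0
  ≡⟨ ℤP.+-identityʳ _ ⟩
    (f ⊛ g) n ∎
  where open ≡-Reasoning

⊛-⊖ˡ : ∀ f g h → (f ⊖ g) ⊛ h ≗ (f ⊛ h) ⊖ (g ⊛ h)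
⊛-⊖ˡ f g h n = trans (sum-cong (suc n) (λ i _ → distrib (h (n ∸ i)) (f i) (g i))) (sum-- (suc n) _ _)
  where
  distrib : ∀ a b c → (b - c) * a ≡ b * a - c * a
  distrib = solve-∀

⊛-⊖ʳ : ∀ f g h → f ⊛ (g ⊖ h) ≗ (f ⊛ g) ⊖ (f ⊛ h)
⊛-⊖ʳ f g h n = trans (sum-cong (suc n) (λ i _ → distrib (f i) (g (n ∸ i)) (h (n ∸ i)))) (sum-- (suc n) _ _)
  where
  distrib : ∀ a b c → a * (b - c) ≡ a * b - a * c
  distrib = solve-∀

⊛-shiftByˡ : ∀ a f g → shiftBy a f ⊛ g ≗ shiftBy a (f ⊛ g)
⊛-shiftByˡ zero    f g n = refl
⊛-shiftByˡ (suc a) f g n = trans (⊛-shiftˡ (shiftBy a f) g n) (shift-cong (⊛-shiftByˡ a f g) n)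

⊛-shiftByʳ : ∀ a f g → f ⊛ shiftBy a g ≗ shiftBy a (f ⊛ g)
⊛-shiftByʳ zero    f g n = refl
⊛-shiftByʳ (suc a) f g n = trans (⊛-shiftʳ f (shiftBy a g) n) (shift-cong (⊛-shiftByʳ a f g) n)

⊛-Δˡ : ∀ f g → Δ f ⊛ g ≗ Δ (f ⊛ g)
⊛-Δˡ f g n = trans (⊛-⊖ˡ f (shift f) g n) (cong (λ z → (f ⊛ g) n - z) (⊛-shiftˡ f g n))

⊛-Δʳ : ∀ f g → f ⊛ Δ g ≗ Δ (f ⊛ g)
⊛-Δʳ f g n = trans (⊛-⊖ʳ f g (shift g) n) (cong (λ z → (f ⊛ g) n - z) (⊛-shiftʳ f g n))

⊛-Δ^ˡ : ∀ j f g → Δ^ j f ⊛ g ≗ Δ^ j (f ⊛ g)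
⊛-Δ^ˡ zero    f g n = refl
⊛-Δ^ˡ (suc j) f g n = trans (⊛-Δˡ (Δ^ j f) g n) (Δ-cong (⊛-Δ^ˡ j f g) n)

⊛-Δ^ʳ : ∀ j f g → f ⊛ Δ^ j g ≗ Δ^ j (f ⊛ g)
⊛-Δ^ʳ zero    f g n = refl
⊛-Δ^ʳ (suc j) f g n = trans (⊛-Δʳ f (Δ^ j g) n) (Δ-cong (⊛-Δ^ʳ j f g) n)

oneMinusPow : ℕ → Series → Series
oneMinusPow a f = f ⊖ shiftBy a f

oneMinusPows : ∀ {j} → Vec ℕ j → Series → Series
oneMinusPows Vec.[]       f = f
oneMinusPows (a Vec.∷ ν) f = oneMinusPow a (oneMinusPows ν f)

oneMinusPow-cong : ∀ a {f g} → f ≗ g → oneMinusPow a f ≗ oneMinusPow a g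
oneMinusPow-cong a eq = ⊖-cong eq (shiftBy-cong a eq)

Δ-qInt : ∀ a → Δ (qInt a) ≗ one ⊖ shiftBy a one
Δ-qInt zero    zero    = refl
Δ-qInt zero    (suc n) = refl
Δ-qInt (suc a) zero    = refl
Δ-qInt (suc a) (suc n) = begin
    qInt (suc a) (suc n) - qInt (suc a) n
  ≡⟨ cong (λ z → qInt a n - z) (qInt-suc n) ⟩
    qInt a n - (shift (qInt a) n + one n)
  ≡⟨ regroup (qInt a n) (shift (qInt a) n) (one n) ⟩
    Δ (qInt a) n - one n
  ≡⟨ cong (_- one n) (Δ-qInt a n) ⟩
    (one n - shiftBy a one n) - one n
  ≡⟨ cancel (one n) (shiftBy a one n) ⟩
    + 0 - shiftBy a one n ∎
  where
  open ≡-Reasoning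
  qInt-suc : ∀ n → qInt (suc a) n ≡ shift (qInt a) n + one n
  qInt-suc zero    = refl
  qInt-suc (suc n) = sym (ℤP.+-identityʳ _)
  regroup : ∀ x y z → x - (y + z) ≡ (x - y) - z
  regroup = solve-∀
  cancel : ∀ x y → (x - y) - x ≡ + 0 - y
  cancel = solve-∀

⊛-Δ^-prodQInt : ∀ {j} (ν : Vec ℕ j) f → f ⊛ Δ^ j (prodVec (Vec.map qInt ν)) ≗ oneMinusPows ν f
⊛-Δ^-prodQInt Vec.[] f n = ⊛-identityʳ f n
⊛-Δ^-prodQInt {suc j} (a Vec.∷ ν) f n = begin
    (f ⊛ Δ (Δ^ j (qInt a ⊛ R))) n
  ≡⟨ ⊛-congʳ f (Δ-cong (λ m → sym (⊛-Δ^ʳ j (qInt a) R m))) n ⟩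
    (f ⊛ Δ (qInt a ⊛ Δ^ j R)) n
  ≡⟨ ⊛-congʳ f (λ m → sym (⊛-Δˡ (qInt a) (Δ^ j R) m)) n ⟩
    (f ⊛ (Δ (qInt a) ⊛ Δ^ j R)) n
  ≡⟨ ⊛-congʳ f (⊛-congˡ (Δ^ j R) (Δ-qInt a)) n ⟩
    (f ⊛ ((one ⊖ shiftBy a one) ⊛ Δ^ j R)) n
  ≡⟨ ⊛-congʳ f factor n ⟩
    (f ⊛ oneMinusPow a (Δ^ j R)) n
  ≡⟨ ⊛-⊖ʳ f (Δ^ j R) (shiftBy a (Δ^ j R)) n ⟩
    (f ⊛ Δ^ j R) n - (f ⊛ shiftBy a (Δ^ j R)) n
  ≡⟨ cong (λ z → (f ⊛ Δ^ j R) n - z) (⊛-shiftByʳ a f _ n) ⟩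
    oneMinusPow a (f ⊛ Δ^ j R) n
  ≡⟨ oneMinusPow-cong a (⊛-Δ^-prodQInt ν f) n ⟩
    oneMinusPows (a Vec.∷ ν) f n ∎
  where
  open ≡-Reasoning
  R = prodVec (Vec.map qInt ν)
  factor : (one ⊖ shiftBy a one) ⊛ Δ^ j R ≗ oneMinusPow a (Δ^ j R)
  factor m = begin
      ((one ⊖ shiftBy a one) ⊛ Δ^ j R) m
    ≡⟨ ⊛-⊖ˡ one (shiftBy a one) (Δ^ j R) m ⟩
      (one ⊛ Δ^ j R) m - (shiftBy a one ⊛ Δ^ j R) m
    ≡⟨ cong₂ _-_ (⊛-identityˡ (Δ^ j R) m) (⊛-shiftByˡ a one (Δ^ j R) m) ⟩
      Δ^ j R m - shiftBy a (one ⊛ Δ^ j R) m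
    ≡⟨ cong (λ z → Δ^ j R m - z) (shiftBy-cong a (⊛-identityˡ (Δ^ j R)) m) ⟩
      oneMinusPow a (Δ^ j R) m ∎

-- Threshold polynomials and their discrete derivative
--
-- A list of thresholds σ = (s₁, …, s_m) determines the polynomial
--   tpoly σ x = Π_i (x + s_i - (i - 1)).
-- Removing one threshold s_i and lowering all others by one ("dropping" s_i) relates
-- tpoly σ to its difference tpoly σ x - tpoly σ (x - 1), in the manner of a product rule.

tpoly : List ℕ → ℤ → ℤ
tpoly []      x = + 1
tpoly (s ∷ σ) x = (x + + s) * tpoly σ (x - + 1)

tpolySeries : List ℕ → Series
tpolySeries σ n = tpoly σ (+ n)

-- Σ_i F (σ with s_i dropped) x, over the positions with s_i > 0 and with s_i = 0 respectively.
dropSum⁺ : (List ℕ → ℤ → ℤ) → List ℕ → ℤ → ℤ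
dropSum⁺ F []          x = + 0
dropSum⁺ F (zero ∷ σ)  x = dropSum⁺ (λ τ → F (0 ∷ τ)) σ x
dropSum⁺ F (suc s ∷ σ) x = F (map ℕ.pred σ) x + dropSum⁺ (λ τ → F (s ∷ τ)) σ x

dropSum⁰ : (List ℕ → ℤ → ℤ) → List ℕ → ℤ → ℤ
dropSum⁰ F []          x = + 0
dropSum⁰ F (zero ∷ σ)  x = F (map ℕ.pred σ) x + dropSum⁰ (λ τ → F (0 ∷ τ)) σ x
dropSum⁰ F (suc s ∷ σ) x = dropSum⁰ (λ τ → F (s ∷ τ)) σ x

dropSum⁺-factor : ∀ σ (g : ℤ → ℤ) (F : List ℕ → ℤ → ℤ) x →
                  dropSum⁺ (λ τ y → g y * F τ (y - + 1)) σ x ≡ g x * dropSum⁺ F σ (x - + 1)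
dropSum⁺-factor []          g F x = sym (ℤP.*-zeroʳ (g x))
dropSum⁺-factor (zero ∷ σ)  g F x = dropSum⁺-factor σ g (λ τ → F (0 ∷ τ)) x
dropSum⁺-factor (suc s ∷ σ) g F x =
  trans (cong (λ z → g x * F (map ℕ.pred σ) (x - + 1) + z) (dropSum⁺-factor σ g (λ τ → F (s ∷ τ)) x))
        (sym (ℤP.*-distribˡ-+ (g x) _ _))

dropSum⁰-factor : ∀ σ (g : ℤ → ℤ) (F : List ℕ → ℤ → ℤ) x →
                  dropSum⁰ (λ τ y → g y * F τ (y - + 1)) σ x ≡ g x * dropSum⁰ F σ (x - + 1)
dropSum⁰-factor []          g F x = sym (ℤP.*-zeroʳ (g x))
dropSum⁰-factor (zero ∷ σ)  g F x =
  trans (cong (λ z → g x * F (map ℕ.pred σ) (x - + 1) + z) (dropSum⁰-factor σ g (λ τ → F (0 ∷ τ)) x))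
        (sym (ℤP.*-distribˡ-+ (g x) _ _))
dropSum⁰-factor (suc s ∷ σ) g F x = dropSum⁰-factor σ g (λ τ → F (s ∷ τ)) x

drops⁺ drops⁰ : List ℕ → ℤ → ℤ
drops⁺ = dropSum⁺ tpoly
drops⁰ = dropSum⁰ tpoly

drops⁺-zero : ∀ σ x → drops⁺ (0 ∷ σ) x ≡ (x + + 0) * drops⁺ σ (x - + 1)
drops⁺-zero σ x = dropSum⁺-factor σ (λ y → y + + 0) tpoly x

drops⁺-suc : ∀ s σ x → drops⁺ (suc s ∷ σ) x ≡ tpoly (map ℕ.pred σ) x + (x + + s) * drops⁺ σ (x - + 1)
drops⁺-suc s σ x = cong (λ z → tpoly (map ℕ.pred σ) x + z) (dropSum⁺-factor σ (λ y → y + + s) tpoly x)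

drops⁰-zero : ∀ σ x → drops⁰ (0 ∷ σ) x ≡ tpoly (map ℕ.pred σ) x + (x + + 0) * drops⁰ σ (x - + 1)
drops⁰-zero σ x = cong (λ z → tpoly (map ℕ.pred σ) x + z) (dropSum⁰-factor σ (λ y → y + + 0) tpoly x)

drops⁰-suc : ∀ s σ x → drops⁰ (suc s ∷ σ) x ≡ (x + + s) * drops⁰ σ (x - + 1)
drops⁰-suc s σ x = dropSum⁰-factor σ (λ y → y + + s) tpoly x

Positive : List ℕ → Set
Positive []      = ⊤
Positive (s ∷ σ) = 1 ≤ s × Positive σ

-- Staircase a k σ: σ is weakly increasing, s₁ ≥ a, and s_i ≤ k + (i - 1).
Staircase : ℕ → ℕ → List ℕ → Set
Staircase a k []      = ⊤
Staircase a k (s ∷ σ) = a ≤ s × s ≤ k × Staircase s (suc k) σ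

staircase-positive : ∀ {a k} σ → 1 ≤ a → Staircase a k σ → Positive σ
staircase-positive []      _   _                = tt
staircase-positive (s ∷ σ) 1≤a (a≤s , _ , sc) =
  ℕP.≤-trans 1≤a a≤s , staircase-positive σ (ℕP.≤-trans 1≤a a≤s) sc

tpoly-pred : ∀ σ → Positive σ → ∀ x → tpoly (map ℕ.pred σ) x ≡ tpoly σ (x - + 1)
tpoly-pred []          _        x = refl
tpoly-pred (suc s ∷ σ) (_ , ps) x =
  trans (cong ((x + + s) *_) (tpoly-pred σ ps (x - + 1))) (cong (_* tpoly σ (x - + 1 - + 1)) (shuffle x (+ s)))
  where
  shuffle : ∀ x s → x + s ≡ x - + 1 + (+ 1 + s)
  shuffle = solve-∀

drops-positive : ∀ σ → Positive σ → ∀ x → drops⁰ σ x ≡ + 0 × drops⁺ σ x ≡ tpoly σ x - tpoly σ (x - + 1)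
drops-positive []          _        x = refl , refl
drops-positive (suc s ∷ σ) (_ , ps) x =
  trans (drops⁰-suc s σ x) (trans (cong ((x + + s) *_) (proj₁ (drops-positive σ ps (x - + 1)))) (ℤP.*-zeroʳ (x + + s))) ,
  trans (drops⁺-suc s σ x)
        (trans (cong₂ (λ a b → a + (x + + s) * b) (tpoly-pred σ ps x) (proj₂ (drops-positive σ ps (x - + 1))))
               (expand x (+ s) (tpoly σ (x - + 1)) (tpoly σ (x - + 1 - + 1))))
  where
  expand : ∀ x s a b → a + (x + s) * (a - b) ≡ (x + (+ 1 + s)) * a - (x - + 1 + (+ 1 + s)) * b
  expand = solve-∀

drops⁰-staircase : ∀ {a k} σ → Staircase a k σ → ∀ x → drops⁰ σ (x - + 1) ≡ tpoly (map ℕ.pred σ) x - tpoly σ (x - + 1)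
drops⁰-staircase []          _            x = refl
drops⁰-staircase (zero ∷ σ)  (_ , _ , sc) x = begin
    drops⁰ (0 ∷ σ) (x - + 1)
  ≡⟨ drops⁰-zero σ (x - + 1) ⟩
    A + (x - + 1 + + 0) * drops⁰ σ (x - + 1 - + 1)
  ≡⟨ cong (λ z → A + (x - + 1 + + 0) * z) (drops⁰-staircase σ sc (x - + 1)) ⟩
    A + (x - + 1 + + 0) * (A - B)
  ≡⟨ expand x A B ⟩
    (x + + 0) * A - (x - + 1 + + 0) * B ∎
  where
  open ≡-Reasoning
  A = tpoly (map ℕ.pred σ) (x - + 1)
  B = tpoly σ (x - + 1 - + 1)
  expand : ∀ x A B → A + (x - + 1 + + 0) * (A - B) ≡ (x + + 0) * A - (x - + 1 + + 0) * B
  expand = solve-∀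
drops⁰-staircase (suc s ∷ σ) (_ , _ , sc) x = begin
    drops⁰ (suc s ∷ σ) (x - + 1)
  ≡⟨ proj₁ (drops-positive (suc s ∷ σ) ps (x - + 1)) ⟩
    + 0
  ≡⟨ sym (ℤP.+-inverseʳ (tpoly (suc s ∷ σ) (x - + 1))) ⟩
    tpoly (suc s ∷ σ) (x - + 1) - tpoly (suc s ∷ σ) (x - + 1)
  ≡⟨ cong (_- tpoly (suc s ∷ σ) (x - + 1)) (sym (tpoly-pred (suc s ∷ σ) ps x)) ⟩
    tpoly (map ℕ.pred (suc s ∷ σ)) x - tpoly (suc s ∷ σ) (x - + 1) ∎
  where
  open ≡-Reasoning
  ps : Positive (suc s ∷ σ)
  ps = s≤s z≤n , staircase-positive σ (s≤s z≤n) sc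

drops-staircase : ∀ {a k} σ → Staircase a k σ → ∀ x → drops⁺ σ x + drops⁰ σ (x - + 1) ≡ tpoly σ x - tpoly σ (x - + 1)
drops-staircase []          _            x = refl
drops-staircase (zero ∷ σ)  (_ , _ , sc) x = begin
    drops⁺ (0 ∷ σ) x + drops⁰ (0 ∷ σ) (x - + 1)
  ≡⟨ cong₂ _+_ (drops⁺-zero σ x) (drops⁰-zero σ (x - + 1)) ⟩
    (x + + 0) * drops⁺ σ (x - + 1) + (A + (x - + 1 + + 0) * W)
  ≡⟨ cong (λ z → (x + + 0) * z + (A + (x - + 1 + + 0) * W)) previous ⟩
    (x + + 0) * (p₁ - p₂ - W) + (A + (x - + 1 + + 0) * W)
  ≡⟨ cong (λ w → (x + + 0) * (p₁ - p₂ - w) + (A + (x - + 1 + + 0) * w)) (drops⁰-staircase σ sc (x - + 1)) ⟩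
    (x + + 0) * (p₁ - p₂ - (A - p₂)) + (A + (x - + 1 + + 0) * (A - p₂))
  ≡⟨ expand x A p₁ p₂ ⟩
    (x + + 0) * p₁ - (x - + 1 + + 0) * p₂ ∎
  where
  open ≡-Reasoning
  A  = tpoly (map ℕ.pred σ) (x - + 1)
  p₁ = tpoly σ (x - + 1)
  p₂ = tpoly σ (x - + 1 - + 1)
  W  = drops⁰ σ (x - + 1 - + 1)
  previous : drops⁺ σ (x - + 1) ≡ p₁ - p₂ - W
  previous = solveFor (drops-staircase σ sc (x - + 1))
    where
    solveFor : ∀ {a b c} → a + b ≡ c → a ≡ c - b
    solveFor {a} {b} refl = cancel a b
      where
      cancel : ∀ a b → a ≡ a + b - b
      cancel = solve-∀
  expand : ∀ x A p₁ p₂ → (x + + 0) * (p₁ - p₂ - (A - p₂)) + (A + (x - + 1 + + 0) * (A - p₂)) ≡ (x + + 0) * p₁ - (x - + 1 + + 0) * p₂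
  expand = solve-∀
drops-staircase (suc s ∷ σ) (_ , _ , sc) x =
  trans (cong₂ _+_ (proj₂ (drops-positive (suc s ∷ σ) ps x)) (proj₁ (drops-positive (suc s ∷ σ) ps (x - + 1))))
        (ℤP.+-identityʳ _)
  where
  ps : Positive (suc s ∷ σ)
  ps = s≤s z≤n , staircase-positive σ (s≤s z≤n) sc

drops⁺-at-0 : ∀ s σ → Staircase 0 1 (s ∷ σ) → drops⁺ (s ∷ σ) (+ 0) ≡ tpoly (s ∷ σ) (+ 0)
drops⁺-at-0 zero          σ _            = drops⁺-zero σ (+ 0)
drops⁺-at-0 (suc zero)    σ (_ , _ , sc) = trans (proj₂ (drops-positive (1 ∷ σ) ps (+ 0))) (ℤP.+-identityʳ _)
  where
  ps : Positive (1 ∷ σ)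
  ps = s≤s z≤n , staircase-positive σ (s≤s z≤n) sc
drops⁺-at-0 (suc (suc s)) σ (_ , s≤s () , _)

below : ℕ → ℕ → ℕ
below s x = if does (s ℕ.≤? x) then 1 else 0

-- dropSeries F σ = Σ_i t^{[s_i = 0]} F (σ with s_i dropped).
dropSeries : (List ℕ → Series) → List ℕ → Series
dropSeries F []      n = + 0
dropSeries F (s ∷ σ) n = shiftBy (below s 0) (F (map ℕ.pred σ)) n + dropSeries (λ τ → F (ℕ.pred s ∷ τ)) σ n

dropSeries-split : ∀ σ (F : List ℕ → ℤ → ℤ) n →
                   dropSeries (λ τ m → F τ (+ m)) σ n ≡ dropSum⁺ F σ (+ n) + shift (λ m → dropSum⁰ F σ (+ m)) n
dropSeries-split []          F zero    = refl
dropSeries-split []          F (suc n) = refl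
dropSeries-split (zero ∷ σ)  F n rewrite dropSeries-split σ (λ τ → F (0 ∷ τ)) n = regroup n
  where
  R⁺ = dropSum⁺ (λ τ → F (0 ∷ τ)) σ
  R⁰ = dropSum⁰ (λ τ → F (0 ∷ τ)) σ
  regroup : ∀ n → shift (λ m → F (map ℕ.pred σ) (+ m)) n + (R⁺ (+ n) + shift (λ m → R⁰ (+ m)) n)
                ≡ R⁺ (+ n) + shift (λ m → F (map ℕ.pred σ) (+ m) + R⁰ (+ m)) n
  regroup zero    = ring (R⁺ (+ 0))
    where
    ring : ∀ a → + 0 + (a + + 0) ≡ a + + 0
    ring = solve-∀
  regroup (suc n) = ring (F (map ℕ.pred σ) (+ n)) (R⁺ (+ suc n)) (R⁰ (+ n))
    where
    ring : ∀ a b c → a + (b + c) ≡ b + (a + c)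
    ring = solve-∀
dropSeries-split (suc s ∷ σ) F n rewrite dropSeries-split σ (λ τ → F (s ∷ τ)) n =
  sym (ℤP.+-assoc (F (map ℕ.pred σ) (+ n)) (dropSum⁺ (λ τ → F (s ∷ τ)) σ (+ n)) (shift (λ m → dropSum⁰ (λ τ → F (s ∷ τ)) σ (+ m)) n))

dropSeries-tpoly : ∀ s σ → Staircase 0 1 (s ∷ σ) → dropSeries tpolySeries (s ∷ σ) ≗ Δ (tpolySeries (s ∷ σ))
dropSeries-tpoly s σ sc n = trans (dropSeries-split (s ∷ σ) tpoly n) (atEach n)
  where
  atEach : ∀ n → drops⁺ (s ∷ σ) (+ n) + shift (λ m → drops⁰ (s ∷ σ) (+ m)) n ≡ Δ (tpolySeries (s ∷ σ)) n
  atEach zero    = trans (ℤP.+-identityʳ _) (trans (drops⁺-at-0 s σ sc) (sym (ℤP.+-identityʳ _)))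
  atEach (suc n) = drops-staircase (s ∷ σ) sc (+ suc n)

dropSeries-cong : ∀ σ {F G : List ℕ → Series} → (∀ τ → F τ ≗ G τ) → dropSeries F σ ≗ dropSeries G σ
dropSeries-cong []      eq n = refl
dropSeries-cong (s ∷ σ) eq n =
  cong₂ _+_ (shiftBy-cong (below s 0) (eq (map ℕ.pred σ)) n) (dropSeries-cong σ (λ τ → eq (ℕ.pred s ∷ τ)) n)

dropSeries-+ : ∀ σ (F G : List ℕ → Series) n →
               dropSeries (λ τ m → F τ m + G τ m) σ n ≡ dropSeries F σ n + dropSeries G σ n
dropSeries-+ []      F G n = refl
dropSeries-+ (s ∷ σ) F G n
  rewrite shiftBy-+ˢ (below s 0) (F (map ℕ.pred σ)) (G (map ℕ.pred σ)) n
        | dropSeries-+ σ (λ τ → F (ℕ.pred s ∷ τ)) (λ τ → G (ℕ.pred s ∷ τ)) n =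
  interchange (shiftBy (below s 0) (F (map ℕ.pred σ)) n) (shiftBy (below s 0) (G (map ℕ.pred σ)) n)
              (dropSeries (λ τ → F (ℕ.pred s ∷ τ)) σ n) (dropSeries (λ τ → G (ℕ.pred s ∷ τ)) σ n)
  where
  interchange : ∀ a b c d → a + b + (c + d) ≡ a + c + (b + d)
  interchange = solve-∀

dropSeries-⊖ : ∀ σ (F G : List ℕ → Series) n →
               dropSeries (λ τ → F τ ⊖ G τ) σ n ≡ dropSeries F σ n - dropSeries G σ n
dropSeries-⊖ []      F G n = refl
dropSeries-⊖ (s ∷ σ) F G n
  rewrite shiftBy-⊖ (below s 0) (F (map ℕ.pred σ)) (G (map ℕ.pred σ)) n
        | dropSeries-⊖ σ (λ τ → F (ℕ.pred s ∷ τ)) (λ τ → G (ℕ.pred s ∷ τ)) n =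
  interchange (shiftBy (below s 0) (F (map ℕ.pred σ)) n) (shiftBy (below s 0) (G (map ℕ.pred σ)) n)
              (dropSeries (λ τ → F (ℕ.pred s ∷ τ)) σ n) (dropSeries (λ τ → G (ℕ.pred s ∷ τ)) σ n)
  where
  interchange : ∀ a b c d → a - b + (c - d) ≡ a + c - (b + d)
  interchange = solve-∀

dropSeries-zero : ∀ σ n → dropSeries (λ _ _ → + 0) σ n ≡ + 0
dropSeries-zero []      n = refl
dropSeries-zero (s ∷ σ) n rewrite shiftBy-zero (below s 0) n | dropSeries-zero σ n = refl

dropSeries-shiftBy : ∀ σ a (G : List ℕ → Series) n →
                     dropSeries (λ τ → shiftBy a (G τ)) σ n ≡ shiftBy a (dropSeries G σ) n
dropSeries-shiftBy []      a G n = sym (shiftBy-zero a n)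
dropSeries-shiftBy (s ∷ σ) a G n =
  trans (cong₂ _+_ (shiftBy-comm (below s 0) a (G (map ℕ.pred σ)) n) (dropSeries-shiftBy σ a (λ τ → G (ℕ.pred s ∷ τ)) n))
        (sym (shiftBy-+ˢ a (shiftBy (below s 0) (G (map ℕ.pred σ))) (dropSeries (λ τ → G (ℕ.pred s ∷ τ)) σ) n))

dropSeries-Δ : ∀ σ (F : List ℕ → Series) → dropSeries (λ τ → Δ (F τ)) σ ≗ Δ (dropSeries F σ)
dropSeries-Δ σ F n = trans (dropSeries-⊖ σ F (λ τ → shift (F τ)) n) (cong (λ z → dropSeries F σ n - z) (dropSeries-shiftBy σ 1 F n))

dropSeries-Δ^ : ∀ j σ (F : List ℕ → Series) → dropSeries (λ τ → Δ^ j (F τ)) σ ≗ Δ^ j (dropSeries F σ)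
dropSeries-Δ^ zero    σ F n = refl
dropSeries-Δ^ (suc j) σ F n = trans (dropSeries-Δ σ (λ τ → Δ^ j (F τ)) n) (Δ-cong (dropSeries-Δ^ j σ F) n)

-- AllDrops Q σ: every list obtained from σ by dropping one threshold satisfies Q.
AllDrops : (List ℕ → Set) → List ℕ → Set
AllDrops Q []      = ⊤
AllDrops Q (s ∷ σ) = Q (map ℕ.pred σ) × AllDrops (λ τ → Q (ℕ.pred s ∷ τ)) σ

AllDrops-map : ∀ σ {Q Q′ : List ℕ → Set} → (∀ τ → Q τ → Q′ τ) → AllDrops Q σ → AllDrops Q′ σ
AllDrops-map []      f ok       = tt
AllDrops-map (s ∷ σ) f (q , ok) = f _ q , AllDrops-map σ (λ τ → f (ℕ.pred s ∷ τ)) ok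

dropSeries-congᴰ : ∀ σ (Q : List ℕ → Set) {F G : List ℕ → Series} →
                   (∀ τ → Q τ → F τ ≗ G τ) → AllDrops Q σ → dropSeries F σ ≗ dropSeries G σ
dropSeries-congᴰ []      Q eq ok       n = refl
dropSeries-congᴰ (s ∷ σ) Q eq (q , ok) n =
  cong₂ _+_ (shiftBy-cong (below s 0) (eq (map ℕ.pred σ) q) n)
            (dropSeries-congᴰ σ (λ τ → Q (ℕ.pred s ∷ τ)) (λ τ → eq (ℕ.pred s ∷ τ)) ok n)

staircase-weaken : ∀ {a a′ k k′} σ → a′ ≤ a → k ≤ k′ → Staircase a k σ → Staircase a′ k′ σ
staircase-weaken []      _     _     _                = tt
staircase-weaken (s ∷ σ) a′≤a k≤k′ (a≤s , s≤k , sc) =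
  ℕP.≤-trans a′≤a a≤s , ℕP.≤-trans s≤k k≤k′ , staircase-weaken σ ℕP.≤-refl (s≤s k≤k′) sc

staircase-pred : ∀ {a k} τ → Staircase a (suc k) τ → Staircase (ℕ.pred a) k (map ℕ.pred τ)
staircase-pred []      _                = tt
staircase-pred (s ∷ τ) (a≤s , s≤sk , sc) = ℕP.pred-mono-≤ a≤s , ℕP.pred-mono-≤ s≤sk , staircase-pred τ sc

staircase-drops : ∀ σ a k → Staircase a k σ → AllDrops (λ τ → Staircase (ℕ.pred a) k τ × suc (length τ) ≡ length σ) σ
staircase-drops []      a k _                  = tt
staircase-drops (s ∷ σ) a k (a≤s , s≤k , sc) =
  (staircase-weaken (map ℕ.pred σ) (ℕP.pred-mono-≤ a≤s) ℕP.≤-refl (staircase-pred σ sc) , cong suc (ListP.length-map ℕ.pred σ)) ,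
  AllDrops-map σ (λ τ (scτ , lenτ) → (ℕP.pred-mono-≤ a≤s , ℕP.≤-trans ℕP.pred[n]≤n s≤k , scτ) , cong suc lenτ)
               (staircase-drops σ s (suc k) sc)

-- Worpitzky's identity
--
-- For every staircase σ of
-- length m,   Σ_{u ∈ S(0..m-1)} t^{hits σ u} = (1 - t)^{m+1} Σ_n tpoly σ n t^n.
-- A permutation of 0..m is a permutation u of 0..m-1, raised by one, with 0 inserted at
-- some position i; its hits are [s_i ≤ 0] plus the hits of u against σ with s_i dropped.
-- So the left side for σ is dropSeries of the left sides for the drops of σ, which by
-- induction is dropSeries of (1-t)^{m+1} tpolySeries, i.e. (1-t)^{m+2} tpolySeries σ.
-- The thresholds (1, 2, …, k) turn hits into excedances and tpoly into (x + 1)^k.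

hits : List ℕ → List ℕ → ℕ
hits []      _       = 0
hits (_ ∷ _) []      = 0
hits (s ∷ σ) (x ∷ u) = below s x ℕ.+ hits σ u

monomial : ℕ → Series
monomial zero    zero    = + 1
monomial zero    (suc _) = + 0
monomial (suc c) zero    = + 0
monomial (suc c) (suc n) = monomial c n

hitPoly : List ℕ → List (List ℕ) → Series
hitPoly σ []      n = + 0
hitPoly σ (u ∷ L) n = monomial (hits σ u) n + hitPoly σ L n

monomial-+ : ∀ b c → monomial (b ℕ.+ c) ≗ shiftBy b (monomial c)
monomial-+ zero    c n       = refl
monomial-+ (suc b) c zero    = refl
monomial-+ (suc b) c (suc n) = monomial-+ b c n

monomial-diag : ∀ c → monomial c c ≡ + 1
monomial-diag zero    = refl
monomial-diag (suc c) = monomial-diag c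

monomial-offdiag : ∀ c j → c ≢ j → monomial c j ≡ + 0
monomial-offdiag zero    zero    c≢j = ⊥-elim (c≢j refl)
monomial-offdiag zero    (suc j) c≢j = refl
monomial-offdiag (suc c) zero    c≢j = refl
monomial-offdiag (suc c) (suc j) c≢j = monomial-offdiag c j (λ e → c≢j (cong suc e))

below-suc : ∀ s y → below s (suc y) ≡ below (ℕ.pred s) y
below-suc zero    y = refl
below-suc (suc s) y = cong (λ b → if b then 1 else 0) (does-⇔ ℕP.≤-pred s≤s (suc s ℕ.≤? suc y) (s ℕ.≤? y))

hits-suc : ∀ σ u → hits σ (map suc u) ≡ hits (map ℕ.pred σ) u
hits-suc []      u       = refl
hits-suc (s ∷ σ) []      = refl
hits-suc (s ∷ σ) (x ∷ u) = cong₂ ℕ._+_ (below-suc s x) (hits-suc σ u)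

hitPoly-cons : ∀ s σ x L → hitPoly (s ∷ σ) (map (x ∷_) L) ≗ shiftBy (below s x) (hitPoly σ L)
hitPoly-cons s σ x []      n = sym (shiftBy-zero (below s x) n)
hitPoly-cons s σ x (u ∷ L) n =
  trans (cong₂ _+_ (monomial-+ (below s x) (hits σ u) n) (hitPoly-cons s σ x L n))
        (sym (shiftBy-+ˢ (below s x) (monomial (hits σ u)) (hitPoly σ L) n))

hitPoly-++ : ∀ σ A B n → hitPoly σ (A ++ B) n ≡ hitPoly σ A n + hitPoly σ B n
hitPoly-++ σ []      B n = sym (ℤP.+-identityˡ _)
hitPoly-++ σ (u ∷ A) B n rewrite hitPoly-++ σ A B n = sym (ℤP.+-assoc (monomial (hits σ u) n) (hitPoly σ A n) (hitPoly σ B n))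

hitPoly-insert0 : ∀ σ u → length σ ≡ suc (length u) →
                  hitPoly σ (insertions 0 (map suc u)) ≗ dropSeries (λ τ → monomial (hits τ u)) σ
hitPoly-insert0 (zero ∷ [])  [] _ zero    = refl
hitPoly-insert0 (zero ∷ [])  [] _ (suc n) = refl
hitPoly-insert0 (suc s ∷ []) [] _ n       = refl
hitPoly-insert0 (s ∷ σ) (y ∷ u) len n = begin
    monomial (hits (s ∷ σ) (0 ∷ suc y ∷ map suc u)) n + hitPoly (s ∷ σ) (map (suc y ∷_) inserted) n
  ≡⟨ cong₂ _+_ atFront (hitPoly-cons s σ (suc y) inserted n) ⟩
    shiftBy (below s 0) (monomial (hits (map ℕ.pred σ) (y ∷ u))) n + shiftBy b (hitPoly σ inserted) n
  ≡⟨ cong (λ z → shiftBy (below s 0) (monomial (hits (map ℕ.pred σ) (y ∷ u))) n + z) later ⟩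
    dropSeries (λ τ → monomial (hits τ (y ∷ u))) (s ∷ σ) n ∎
  where
  open ≡-Reasoning
  inserted = insertions 0 (map suc u)
  b = below s (suc y)
  atFront : monomial (hits (s ∷ σ) (0 ∷ suc y ∷ map suc u)) n ≡ shiftBy (below s 0) (monomial (hits (map ℕ.pred σ) (y ∷ u))) n
  atFront = trans (cong (λ c → monomial (below s 0 ℕ.+ c) n) (hits-suc σ (y ∷ u))) (monomial-+ (below s 0) _ n)
  later : shiftBy b (hitPoly σ inserted) n ≡ dropSeries (λ τ → monomial (hits (ℕ.pred s ∷ τ) (y ∷ u))) σ n
  later = begin
      shiftBy b (hitPoly σ inserted) n
    ≡⟨ shiftBy-cong b (hitPoly-insert0 σ u (ℕP.suc-injective len)) n ⟩
      shiftBy b (dropSeries (λ τ → monomial (hits τ u)) σ) n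
    ≡⟨ sym (dropSeries-shiftBy σ b (λ τ → monomial (hits τ u)) n) ⟩
      dropSeries (λ τ → shiftBy b (monomial (hits τ u))) σ n
    ≡⟨ dropSeries-cong σ (λ τ m → trans (sym (monomial-+ b (hits τ u) m))
                                        (cong (λ c → monomial (c ℕ.+ hits τ u) m) (below-suc s y))) n ⟩
      dropSeries (λ τ → monomial (hits (ℕ.pred s ∷ τ) (y ∷ u))) σ n ∎

hitPoly-insert0-all : ∀ L σ → ListAll.All (λ u → length σ ≡ suc (length u)) L →
                      hitPoly σ (concatMap (λ u → insertions 0 (map suc u)) L) ≗ dropSeries (λ τ → hitPoly τ L) σ
hitPoly-insert0-all []      σ []          n = sym (dropSeries-zero σ n)
hitPoly-insert0-all (u ∷ L) σ (lu ∷ lens) n = begin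
    hitPoly σ (insertions 0 (map suc u) ++ concatMap (λ u → insertions 0 (map suc u)) L) n
  ≡⟨ hitPoly-++ σ (insertions 0 (map suc u)) _ n ⟩
    hitPoly σ (insertions 0 (map suc u)) n + hitPoly σ (concatMap (λ u → insertions 0 (map suc u)) L) n
  ≡⟨ cong₂ _+_ (hitPoly-insert0 σ u lu n) (hitPoly-insert0-all L σ lens n) ⟩
    dropSeries (λ τ → monomial (hits τ u)) σ n + dropSeries (λ τ → hitPoly τ L) σ n
  ≡⟨ sym (dropSeries-+ σ (λ τ → monomial (hits τ u)) (λ τ → hitPoly τ L) n) ⟩
    dropSeries (λ τ → hitPoly τ (u ∷ L)) σ n ∎
  where open ≡-Reasoning

insertions-map : ∀ (f : ℕ → ℕ) x w → insertions (f x) (map f w) ≡ map (map f) (insertions x w)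
insertions-map f x []      = refl
insertions-map f x (y ∷ w) = cong ((f x ∷ f y ∷ map f w) ∷_) (begin
    map (f y ∷_) (insertions (f x) (map f w))
  ≡⟨ cong (map (f y ∷_)) (insertions-map f x w) ⟩
    map (f y ∷_) (map (map f) (insertions x w))
  ≡⟨ sym (ListP.map-∘ (insertions x w)) ⟩
    map (λ r → f y ∷ map f r) (insertions x w)
  ≡⟨ ListP.map-∘ (insertions x w) ⟩
    map (map f) (map (y ∷_) (insertions x w)) ∎)
  where open ≡-Reasoning

perms-map : ∀ (f : ℕ → ℕ) xs → perms (map f xs) ≡ map (map f) (perms xs)
perms-map f []       = refl
perms-map f (x ∷ xs) = begin
    concatMap (insertions (f x)) (perms (map f xs))
  ≡⟨ cong (concatMap (insertions (f x))) (perms-map f xs) ⟩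
    concatMap (insertions (f x)) (map (map f) (perms xs))
  ≡⟨ ListP.concatMap-map (insertions (f x)) (map f) (perms xs) ⟩
    concatMap (λ w → insertions (f x) (map f w)) (perms xs)
  ≡⟨ ListP.concatMap-cong (λ w → insertions-map f x w) (perms xs) ⟩
    concatMap (λ w → map (map f) (insertions x w)) (perms xs)
  ≡⟨ sym (ListP.map-concatMap (map f) (insertions x) (perms xs)) ⟩
    map (map f) (concatMap (insertions x) (perms xs)) ∎
  where open ≡-Reasoning

perms-upTo-suc : ∀ m → perms (upTo (suc m)) ≡ concatMap (λ u → insertions 0 (map suc u)) (perms (upTo m))
perms-upTo-suc m = begin
    concatMap (insertions 0) (perms (applyUpTo suc m))
  ≡⟨ cong (λ l → concatMap (insertions 0) (perms l)) (sym (ListP.map-upTo suc m)) ⟩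
    concatMap (insertions 0) (perms (map suc (upTo m)))
  ≡⟨ cong (concatMap (insertions 0)) (perms-map suc (upTo m)) ⟩
    concatMap (insertions 0) (map (map suc) (perms (upTo m)))
  ≡⟨ ListP.concatMap-map (insertions 0) (map suc) (perms (upTo m)) ⟩
    concatMap (λ u → insertions 0 (map suc u)) (perms (upTo m)) ∎
  where open ≡-Reasoning

insertions-length : ∀ x w → ListAll.All (λ r → length r ≡ suc (length w)) (insertions x w)
insertions-length x []      = refl ∷ []
insertions-length x (y ∷ w) = refl ∷ ListAllP.map⁺ (ListAll.map (cong suc) (insertions-length x w))

perms-length : ∀ xs → ListAll.All (λ u → length u ≡ length xs) (perms xs)
perms-length []       = refl ∷ []
perms-length (x ∷ xs) = ListAllP.concat⁺ (ListAllP.map⁺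
  (ListAll.map (λ {w} lw → ListAll.map (λ lr → trans lr (cong suc lw)) (insertions-length x w)) (perms-length xs)))

perms-upTo-length : ∀ m → ListAll.All (λ u → length u ≡ m) (perms (upTo m))
perms-upTo-length m = ListAll.map (λ lu → trans lu (ListP.length-upTo m)) (perms-length (upTo m))

worpitzky-staircase : ∀ m σ → length σ ≡ m → Staircase 0 1 σ → hitPoly σ (perms (upTo m)) ≗ Δ^ (suc m) (tpolySeries σ)
worpitzky-staircase zero    []      _   _  zero    = refl
worpitzky-staircase zero    []      _   _  (suc n) = refl
worpitzky-staircase (suc m) (s ∷ σ) len sc n = begin
    hitPoly (s ∷ σ) (perms (upTo (suc m))) n
  ≡⟨ cong (λ L → hitPoly (s ∷ σ) L n) (perms-upTo-suc m) ⟩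
    hitPoly (s ∷ σ) (concatMap (λ u → insertions 0 (map suc u)) (perms (upTo m))) n
  ≡⟨ hitPoly-insert0-all (perms (upTo m)) (s ∷ σ) (ListAll.map (λ lu → trans len (cong suc (sym lu))) (perms-upTo-length m)) n ⟩
    dropSeries (λ τ → hitPoly τ (perms (upTo m))) (s ∷ σ) n
  ≡⟨ dropSeries-congᴰ (s ∷ σ) (λ τ → Staircase 0 1 τ × suc (length τ) ≡ length (s ∷ σ))
       (λ τ (scτ , lenτ) → worpitzky-staircase m τ (ℕP.suc-injective (trans lenτ len)) scτ) (staircase-drops (s ∷ σ) 0 1 sc) n ⟩
    dropSeries (λ τ → Δ^ (suc m) (tpolySeries τ)) (s ∷ σ) n
  ≡⟨ dropSeries-Δ^ (suc m) (s ∷ σ) tpolySeries n ⟩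
    Δ^ (suc m) (dropSeries tpolySeries (s ∷ σ)) n
  ≡⟨ Δ^-cong (suc m) (dropSeries-tpoly s σ sc) n ⟩
    Δ^ (suc m) (Δ (tpolySeries (s ∷ σ))) n
  ≡⟨ Δ^-Δ (suc m) (tpolySeries (s ∷ σ)) n ⟩
    Δ^ (suc (suc m)) (tpolySeries (s ∷ σ)) n ∎
  where open ≡-Reasoning

steps : ℕ → ℕ → List ℕ
steps i zero    = []
steps i (suc m) = i ∷ steps (suc i) m

steps-length : ∀ i m → length (steps i m) ≡ m
steps-length i zero    = refl
steps-length i (suc m) = cong suc (steps-length (suc i) m)

steps-staircase : ∀ a k i m → a ≤ i → i ≤ k → Staircase a k (steps i m)
steps-staircase a k i zero    _   _   = tt
steps-staircase a k i (suc m) a≤i i≤k = a≤i , i≤k , steps-staircase i (suc k) (suc i) m (ℕP.n≤1+n i) (s≤s i≤k)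

tpoly-steps : ∀ i m x → tpoly (steps i m) x ≡ (x + + i) ℤ.^ m
tpoly-steps i zero    x = refl
tpoly-steps i (suc m) x = cong ((x + + i) *_) (trans (tpoly-steps (suc i) m (x - + 1)) (cong (ℤ._^ m) (shuffle x (+ i))))
  where
  shuffle : ∀ x i → x - + 1 + (+ 1 + i) ≡ x + i
  shuffle = solve-∀

exc-steps : ∀ i u → excFrom i (map suc u) ≡ hits (steps i (length u)) u
exc-steps i []      = refl
exc-steps i (w ∷ u) =
  cong₂ ℕ._+_ (cong (λ b → if b then 1 else 0) (does-⇔ ℕP.≤-pred s≤s (suc w ℕ.>? i) (i ℕ.≤? w))) (exc-steps (suc i) u)

count-exc : ∀ σ j L → ListAll.All (λ u → exc (map suc u) ≡ hits σ u) L →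
            + length (filter (λ w → exc w ℕ.≟ j) (map (map suc) L)) ≡ hitPoly σ L j
count-exc σ j []      []          = refl
count-exc σ j (u ∷ L) (eu ∷ eqs) with exc (map suc u) ℕ.≟ j
... | yes e = begin
    + length (filter P? (map suc u ∷ map (map suc) L))
  ≡⟨ cong (λ l → + length l) (ListP.filter-accept P? {map suc u} {map (map suc) L} e) ⟩
    + 1 + + length (filter P? (map (map suc) L))
  ≡⟨ cong₂ _+_ (sym (trans (cong (λ c → monomial c j) (trans (sym eu) e)) (monomial-diag j))) (count-exc σ j L eqs) ⟩
    monomial (hits σ u) j + hitPoly σ L j ∎
  where
  open ≡-Reasoning
  P? = λ w → exc w ℕ.≟ j
... | no ne = begin
    + length (filter P? (map suc u ∷ map (map suc) L))
  ≡⟨ cong (λ l → + length l) (ListP.filter-reject P? {map suc u} {map (map suc) L} ne) ⟩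
    + length (filter P? (map (map suc) L))
  ≡⟨ count-exc σ j L eqs ⟩
    hitPoly σ L j
  ≡⟨ sym (ℤP.+-identityˡ _) ⟩
    + 0 + hitPoly σ L j
  ≡⟨ cong (_+ hitPoly σ L j) (sym (monomial-offdiag (hits σ u) j (λ e → ne (trans eu e)))) ⟩
    monomial (hits σ u) j + hitPoly σ L j ∎
  where
  open ≡-Reasoning
  P? = λ w → exc w ℕ.≟ j

powers : ℕ → Series
powers k n = (+ suc n) ℤ.^ k

eulerian-worpitzky : ∀ k → eulerian k ≗ Δ^ (suc k) (powers k)
eulerian-worpitzky k j = begin
    + length (filter (λ w → exc w ℕ.≟ j) (perms (map suc (upTo k))))
  ≡⟨ cong (λ l → + length (filter (λ w → exc w ℕ.≟ j) l)) (perms-map suc (upTo k)) ⟩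
    + length (filter (λ w → exc w ℕ.≟ j) (map (map suc) (perms (upTo k))))
  ≡⟨ count-exc (steps 1 k) j (perms (upTo k))
       (ListAll.map (λ {u} lu → trans (exc-steps 1 u) (cong (λ m → hits (steps 1 m) u) lu)) (perms-upTo-length k)) ⟩
    hitPoly (steps 1 k) (perms (upTo k)) j
  ≡⟨ worpitzky-staircase k (steps 1 k) (steps-length 1 k) (steps-staircase 0 1 1 k z≤n ℕP.≤-refl) j ⟩
    Δ^ (suc k) (tpolySeries (steps 1 k)) j
  ≡⟨ Δ^-cong (suc k) (λ n → trans (tpoly-steps 1 k (+ n)) (cong (λ z → (+ z) ℤ.^ k) (ℕP.+-comm n 1))) j ⟩
    Δ^ (suc k) (powers k) j ∎
  where open ≡-Reasoning

-- The coefficient formula  t A_k(t) Π_i [ν_i]_t = Π_i (1 - t^{ν_i}) Σ_{n≥1} n^k t^n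

Fser : ∀ {k} → Vec ℕ (suc k) → Series
Fser {k} ν = tSer ⊛ (eulerian k ⊛ prodVec (Vec.map qInt ν))

tSer-shift : tSer ≗ shift one
tSer-shift zero          = refl
tSer-shift (suc zero)    = refl
tSer-shift (suc (suc n)) = refl

-- Worpitzky's (1-t)^{k+1} cancels against Π_i [ν_i]_t = Π_i (1 - t^{ν_i}) / (1-t)^{k+1}.
coefficient-formula : ∀ {k} (ν : Vec ℕ (suc k)) → Fser ν ≗ oneMinusPows ν (shift (powers k))
coefficient-formula {k} ν n = begin
    (tSer ⊛ X) n
  ≡⟨ ⊛-congˡ X tSer-shift n ⟩
    (shift one ⊛ X) n
  ≡⟨ trans (⊛-shiftˡ one X n) (shift-cong (⊛-identityˡ X) n) ⟩
    shift X n
  ≡⟨ shift-cong (⊛-congˡ Q (eulerian-worpitzky k)) n ⟩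
    shift (Δ^ (suc k) (powers k) ⊛ Q) n
  ≡⟨ shift-cong (λ m → trans (⊛-Δ^ˡ (suc k) (powers k) Q m) (sym (⊛-Δ^ʳ (suc k) (powers k) Q m))) n ⟩
    shift (powers k ⊛ Δ^ (suc k) Q) n
  ≡⟨ sym (⊛-shiftˡ (powers k) (Δ^ (suc k) Q) n) ⟩
    (shift (powers k) ⊛ Δ^ (suc k) Q) n
  ≡⟨ ⊛-Δ^-prodQInt ν (shift (powers k)) n ⟩
    oneMinusPows ν (shift (powers k)) n ∎
  where
  open ≡-Reasoning
  Q = prodVec (Vec.map qInt ν)
  X = eulerian k ⊛ Q

-- Dilation: dividing all parts by d rescales the coefficient formula

^-distrib-* : ∀ (x y : ℤ) k → (x * y) ℤ.^ k ≡ x ℤ.^ k * y ℤ.^ k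
^-distrib-* x y zero    = refl
^-distrib-* x y (suc k) rewrite ^-distrib-* x y k = interchange x y (x ℤ.^ k) (y ℤ.^ k)
  where
  interchange : ∀ a b c d → a * b * (c * d) ≡ a * c * (b * d)
  interchange = solve-∀

shiftPowers-dilate : ∀ k d x → shift (powers k) (suc d ℕ.* x) ≡ (+ suc d) ℤ.^ k * shift (powers k) x
shiftPowers-dilate k d zero    rewrite ℕP.*-zeroʳ d = sym (ℤP.*-zeroʳ ((+ suc d) ℤ.^ k))
shiftPowers-dilate k d (suc x) = trans (cong (ℤ._^ k) (ℤP.pos-* (suc d) (suc x))) (^-distrib-* (+ suc d) (+ suc x) k)

oneMinusPow-dilate : ∀ d c (λ′ : ℤ) f g → (∀ x → f (suc d ℕ.* x) ≡ λ′ * g x) →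
                     ∀ x → oneMinusPow (suc d ℕ.* c) f (suc d ℕ.* x) ≡ λ′ * oneMinusPow c g x
oneMinusPow-dilate d c λ′ f g dil x with c ℕP.≤? x
... | yes c≤x = begin
    f (D ℕ.* x) - shiftBy (D ℕ.* c) f (D ℕ.* x)
  ≡⟨ cong (λ z → f (D ℕ.* x) - shiftBy (D ℕ.* c) f z) Dx≡Dc+Dr ⟩
    f (D ℕ.* x) - shiftBy (D ℕ.* c) f (D ℕ.* c ℕ.+ D ℕ.* r)
  ≡⟨ cong (λ z → f (D ℕ.* x) - z) (shiftBy-+ (D ℕ.* c) f (D ℕ.* r)) ⟩
    f (D ℕ.* x) - f (D ℕ.* r)
  ≡⟨ cong₂ _-_ (dil x) (dil r) ⟩
    λ′ * g x - λ′ * g r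
  ≡⟨ sym (distrib λ′ (g x) (g r)) ⟩
    λ′ * (g x - g r)
  ≡⟨ cong (λ z → λ′ * (g x - z)) (sym (trans (cong (shiftBy c g) (sym (ℕP.m+[n∸m]≡n c≤x))) (shiftBy-+ c g r))) ⟩
    λ′ * (g x - shiftBy c g x) ∎
  where
  open ≡-Reasoning
  D = suc d
  r = x ∸ c
  Dx≡Dc+Dr : D ℕ.* x ≡ D ℕ.* c ℕ.+ D ℕ.* r
  Dx≡Dc+Dr = trans (cong (D ℕ.*_) (sym (ℕP.m+[n∸m]≡n c≤x))) (ℕP.*-distribˡ-+ D c r)
  distrib : ∀ a b c → a * (b - c) ≡ a * b - a * c
  distrib = solve-∀
... | no c≰x = begin
    f (D ℕ.* x) - shiftBy (D ℕ.* c) f (D ℕ.* x)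
  ≡⟨ cong (λ z → f (D ℕ.* x) - z) (shiftBy-< (D ℕ.* c) f (D ℕ.* x) (ℕP.*-monoʳ-< D (ℕP.≰⇒> c≰x))) ⟩
    f (D ℕ.* x) - + 0
  ≡⟨ trans (ℤP.+-identityʳ _) (dil x) ⟩
    λ′ * g x
  ≡⟨ cong (λ′ *_) (sym (ℤP.+-identityʳ (g x))) ⟩
    λ′ * (g x - + 0)
  ≡⟨ cong (λ z → λ′ * (g x - z)) (sym (shiftBy-< c g x (ℕP.≰⇒> c≰x))) ⟩
    λ′ * (g x - shiftBy c g x) ∎
  where
  open ≡-Reasoning
  D = suc d

oneMinusPows-dilate : ∀ k d {j} (ν : Vec ℕ j) → VecAll.All (suc d ∣_) ν → ∀ x →
  oneMinusPows ν (shift (powers k)) (suc d ℕ.* x) ≡ (+ suc d) ℤ.^ k * oneMinusPows (Vec.map (_/ suc d) ν) (shift (powers k)) x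
oneMinusPows-dilate k d Vec.[]       []          x = shiftPowers-dilate k d x
oneMinusPows-dilate k d (a Vec.∷ ν) (d∣a ∷ d∣ν) x =
  trans (cong (λ z → oneMinusPow z (oneMinusPows ν (shift (powers k))) (suc d ℕ.* x)) (sym (m*[n/m]≡n d∣a)))
        (oneMinusPow-dilate d (a / suc d) ((+ suc d) ℤ.^ k) (oneMinusPows ν (shift (powers k)))
                            (oneMinusPows (Vec.map (_/ suc d) ν) (shift (powers k))) (oneMinusPows-dilate k d ν d∣ν) x)

substPow-coeff : ∀ d f n → substPow (suc d) f n ≡ (if does (suc d ∣? n) then f (n / suc d) else + 0)
substPow-coeff d f n = byDivisibility (suc d ∣? n)
  where
  term = λ j → if does (suc d ℕ.* j ℕ.≟ n) then f j else + 0
  byDivisibility : (d∣?n : Dec (suc d ∣ n)) → sumBelow (suc n) term ≡ (if does d∣?n then f (n / suc d) else + 0)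
  byDivisibility (yes d∣n) =
    trans (sum-single (suc n) term c vanish (s≤s (m/n≤m n (suc d)))) (if-yes (suc d ℕ.* c ℕ.≟ n) (m*[n/m]≡n d∣n))
    where
    c = n / suc d
    vanish : ∀ j → j < suc n → j ≢ c → term j ≡ + 0
    vanish j _ j≢c = if-no (suc d ℕ.* j ℕ.≟ n) (λ e → j≢c (ℕP.*-cancelˡ-≡ j c (suc d) (trans e (sym (m*[n/m]≡n d∣n)))))
  byDivisibility (no d∤n) =
    trans (sum-cong (suc n) (λ j _ → if-no (suc d ℕ.* j ℕ.≟ n) (λ e → d∤n (divides j (trans (sym e) (ℕP.*-comm (suc d) j))))))
          (sum-zero (suc n))

dilation : ∀ {k} (ν : Vec ℕ (suc k)) e → VecAll.All (suc e ∣_) ν → ∀ n →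
           (+ suc e) ℤ.^ k * substPow (suc e) (tSer ⊛ (eulerian k ⊛ prodVec (Vec.map (λ a → qInt (a / suc e)) ν))) n
           ≡ (if does (suc e ∣? n) then Fser ν n else + 0)
dilation {k} ν e e∣ν n =
  trans (cong ((+ suc e) ℤ.^ k *_) (substPow-coeff e H n)) (byDivisibility (suc e ∣? n))
  where
  H = tSer ⊛ (eulerian k ⊛ prodVec (Vec.map (λ a → qInt (a / suc e)) ν))
  byDivisibility : (e∣?n : Dec (suc e ∣ n)) →
                   (+ suc e) ℤ.^ k * (if does e∣?n then H (n / suc e) else + 0) ≡ (if does e∣?n then Fser ν n else + 0)
  byDivisibility (no _)    = ℤP.*-zeroʳ ((+ suc e) ℤ.^ k)
  byDivisibility (yes e∣n) = begin
      (+ suc e) ℤ.^ k * H m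
    ≡⟨ cong (λ w → (+ suc e) ℤ.^ k * (tSer ⊛ (eulerian k ⊛ prodVec w)) m) (VecP.map-∘ qInt (_/ suc e) ν) ⟩
      (+ suc e) ℤ.^ k * Fser (Vec.map (_/ suc e) ν) m
    ≡⟨ cong ((+ suc e) ℤ.^ k *_) (coefficient-formula (Vec.map (_/ suc e) ν) m) ⟩
      (+ suc e) ℤ.^ k * oneMinusPows (Vec.map (_/ suc e) ν) (shift (powers k)) m
    ≡⟨ sym (oneMinusPows-dilate k e ν e∣ν m) ⟩
      oneMinusPows ν (shift (powers k)) (suc e ℕ.* m)
    ≡⟨ cong (oneMinusPows ν (shift (powers k))) (m*[n/m]≡n e∣n) ⟩
      oneMinusPows ν (shift (powers k)) n
    ≡⟨ sym (coefficient-formula ν n) ⟩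
      Fser ν n ∎
    where
    open ≡-Reasoning
    m = n / suc e

count : (ℕ → Bool) → ℕ → ℕ
count f zero    = 0
count f (suc N) = count f N ℕ.+ (if f N then 1 else 0)

length-filter-upTo : ∀ {P : ℕ → Set} (P? : Decidable P) N → length (filter P? (upTo N)) ≡ count (λ q → does (P? q)) N
length-filter-upTo P? zero    = refl
length-filter-upTo P? (suc N) = begin
    length (filter P? (upTo (suc N)))
  ≡⟨ cong (λ l → length (filter P? l)) (sym (ListP.upTo-∷ʳ N)) ⟩
    length (filter P? (upTo N ++ N ∷ []))
  ≡⟨ cong length (ListP.filter-++ P? (upTo N) (N ∷ [])) ⟩
    length (filter P? (upTo N) ++ filter P? (N ∷ []))
  ≡⟨ ListP.length-++ (filter P? (upTo N)) ⟩
    length (filter P? (upTo N)) ℕ.+ length (filter P? (N ∷ []))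
  ≡⟨ cong₂ ℕ._+_ (length-filter-upTo P? N) lengthSingleton ⟩
    count (λ q → does (P? q)) (suc N) ∎
  where
  open ≡-Reasoning
  lengthSingleton : length (filter P? (N ∷ [])) ≡ (if does (P? N) then 1 else 0)
  lengthSingleton with does (P? N)
  ... | true  = refl
  ... | false = refl

count-cong : ∀ N f g → (∀ q → q < N → f q ≡ g q) → count f N ≡ count g N
count-cong zero    f g eq = refl
count-cong (suc N) f g eq =
  cong₂ ℕ._+_ (count-cong N f g (λ q q<N → eq q (ℕP.m<n⇒m<1+n q<N))) (cong (λ b → if b then 1 else 0) (eq N ℕP.≤-refl))

count-truncate : ∀ f M N → M ≤ N → (∀ q → M ≤ q → f q ≡ false) → count f N ≡ count f M
count-truncate f M zero    z≤n  none = refl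
count-truncate f M (suc N) M≤sN none with M ℕP.≟ suc N
... | yes refl = refl
... | no M≢sN  = trans (cong₂ ℕ._+_ (count-truncate f M N M≤N none) (cong (λ b → if b then 1 else 0) (none N M≤N)))
                       (ℕP.+-identityʳ _)
  where
  M≤N = ℕP.≤-pred (ℕP.≤∧≢⇒< M≤sN M≢sN)

count-one-more : ∀ f g p N → (∀ q → q ≢ p → f q ≡ g q) → f p ≡ true → g p ≡ false → p < N → count f N ≡ suc (count g N)
count-one-more f g p (suc N) agree fp gp p<sN with N ℕP.≟ p
... | yes refl = begin
    count f N ℕ.+ (if f N then 1 else 0)
  ≡⟨ cong₂ ℕ._+_ (count-cong N f g (λ q q<N → agree q (ℕP.<⇒≢ q<N))) (cong (λ b → if b then 1 else 0) fp) ⟩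
    count g N ℕ.+ 1
  ≡⟨ ℕP.+-comm (count g N) 1 ⟩
    suc (count g N)
  ≡⟨ cong suc (sym (ℕP.+-identityʳ (count g N))) ⟩
    suc (count g N ℕ.+ 0)
  ≡⟨ cong (λ b → suc (count g N ℕ.+ (if b then 1 else 0))) (sym gp) ⟩
    suc (count g (suc N)) ∎
  where open ≡-Reasoning
... | no N≢p = cong₂ ℕ._+_ (count-one-more f g p N agree fp gp (ℕP.≤∧≢⇒< (ℕP.≤-pred p<sN) (λ e → N≢p (sym e))))
                          (cong (λ b → if b then 1 else 0) (agree N N≢p))

count-nonzero : ∀ f c N → f c ≡ true → c < N → count f N ≢ 0
count-nonzero f c (suc N) fc c<sN eq with N ℕP.≟ c
... | yes refl rewrite fc = ℕP.m+1+n≢0 (count f N) eq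
... | no N≢c   = count-nonzero f c N fc (ℕP.≤∧≢⇒< (ℕP.≤-pred c<sN) (λ e → N≢c (sym e))) (ℕP.m+n≡0⇒m≡0 (count f N) eq)

prime≢0 : ∀ {p} → Prime p → p ≢ 0
prime≢0 {zero} pp refl with prime⇒nonZero pp
... | ()

prime≢1 : ∀ {p} → Prime p → p ≢ 1
prime≢1 pp refl with prime⇒nonTrivial pp
... | ()

prime-∣-prime : ∀ {p q} → Prime p → Prime q → q ∣ p → q ≡ p
prime-∣-prime pp pq q∣p with prime⇒irreducible pp q∣p
... | inj₁ refl = ⊥-elim (prime≢1 pq refl)
... | inj₂ q≡p  = q≡p

prime-∣-cancel : ∀ {p q m} → Prime p → Prime q → q ≢ p → q ∣ p ℕ.* m → q ∣ m
prime-∣-cancel {p} {q} {m} pp pq q≢p q∣pm with euclidsLemma p m pq q∣pm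
... | inj₁ q∣p = ⊥-elim (q≢p (prime-∣-prime pp pq q∣p))
... | inj₂ q∣m = q∣m

square-∣-cancel : ∀ {p q m} → Prime p → Prime q → ¬ p ∣ m → (q ℕ.* q) ∣ p ℕ.* m → (q ℕ.* q) ∣ m
square-∣-cancel {p} {q} {m} pp pq p∤m qq∣pm with q ℕP.≟ p
... | yes refl = ⊥-elim (p∤m (*-cancelˡ-∣ q {{ℕ.≢-nonZero (prime≢0 pq)}} qq∣pm))
... | no q≢p with prime-∣-cancel pp pq q≢p (∣-trans (divides q refl) qq∣pm)
... | divides m′ refl = *-monoˡ-∣ q q∣m′
  where
  reorder : ∀ p q m′ → p ℕ.* (m′ ℕ.* q) ≡ q ℕ.* (p ℕ.* m′)
  reorder = ℕSolver.solve-∀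
  q∣m′ : q ∣ m′
  q∣m′ = prime-∣-cancel pp pq q≢p (*-cancelˡ-∣ q {{ℕ.≢-nonZero (prime≢0 pq)}} (subst (q ℕ.* q ∣_) (reorder p q m′) qq∣pm))

≤-*-nonzero : ∀ p m → m ≢ 0 → p ≤ p ℕ.* m
≤-*-nonzero p zero    m≢0 = ⊥-elim (m≢0 refl)
≤-*-nonzero p (suc m) _   = ℕP.m≤m*n p (suc m)

prime-factor : ∀ h → h ≢ 0 → h ≢ 1 → Σ ℕ (λ p → Prime p × p ∣ h)
prime-factor h h≢0 h≢1 = fromFactors (PrimeFactorisation.factors F) (PrimeFactorisation.isFactorisation F) (PrimeFactorisation.factorsPrime F)
  where
  F = factorise h {{ℕ.≢-nonZero h≢0}}
  fromFactors : ∀ fs → h ≡ product fs → ListAll.All Prime fs → Σ ℕ (λ p → Prime p × p ∣ h)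
  fromFactors []       h≡1 _        = ⊥-elim (h≢1 h≡1)
  fromFactors (p ∷ fs) h≡  (pp ∷ _) = p , pp , divides (product fs) (trans h≡ (ℕP.*-comm p _))

coprime-prime : ∀ {p D} → Prime p → ¬ p ∣ D → Coprime D p
coprime-prime pp p∤D {i} (i∣D , i∣p) with prime⇒irreducible pp i∣p
... | inj₁ i≡1 = i≡1
... | inj₂ refl = ⊥-elim (p∤D i∣D)

-- The Möbius function on multiples of a prime
--
-- By definition μ(n) = 0 if a prime square divides n and (-1)^ω(n) otherwise, where both
-- conditions are counted among the q ≤ n.

primeDivides? primeSquareDivides? : ℕ → ℕ → Bool
primeDivides?       n q = does (prime? q ×-dec q ∣? n)
primeSquareDivides? n q = does (prime? q ×-dec (q ℕ.* q) ∣? n)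

signOrZero : ℕ → ℕ → ℤ
signOrZero zero    e = (ℤ.- (+ 1)) ℤ.^ e
signOrZero (suc _) e = + 0

mobius-counts : ∀ n → mobius n ≡ signOrZero (count (primeSquareDivides? n) (suc n)) (count (primeDivides? n) (suc n))
mobius-counts n = trans unfold (cong₂ signOrZero (length-filter-upTo (λ q → prime? q ×-dec (q ℕ.* q) ∣? n) (suc n))
                                                 (length-filter-upTo (λ q → prime? q ×-dec q ∣? n) (suc n)))
  where
  unfold : mobius n ≡ signOrZero (length (squareFree? n)) (numPrimeDivs n)
  unfold with squareFree? n
  ... | []    = refl
  ... | _ ∷ _ = refl

-- The divisors of a nonzero m are at most m.
primeSquareDivides?-beyond : ∀ m → m ≢ 0 → ∀ q → suc m ≤ q → primeSquareDivides? m q ≡ false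
primeSquareDivides?-beyond m m≢0 q m<q = dec-false (prime? q ×-dec (q ℕ.* q) ∣? m) λ (pq , qq∣m) →
  ℕP.<-irrefl refl (ℕP.≤-trans m<q (ℕP.≤-trans (≤-*-nonzero q q (prime≢0 pq)) (∣⇒≤ {{ℕ.≢-nonZero m≢0}} qq∣m)))

primeDivides?-beyond : ∀ m → m ≢ 0 → ∀ q → suc m ≤ q → primeDivides? m q ≡ false
primeDivides?-beyond m m≢0 q m<q = dec-false (prime? q ×-dec q ∣? m) λ (pq , q∣m) →
  ℕP.<-irrefl refl (ℕP.≤-trans m<q (∣⇒≤ {{ℕ.≢-nonZero m≢0}} q∣m))

mobius-square : ∀ {p m} → Prime p → p ∣ m → m ≢ 0 → mobius (p ℕ.* m) ≡ + 0
mobius-square {p} {m} pp p∣m m≢0 = trans (mobius-counts (p ℕ.* m)) (nonzeroCount _ _ squareCounted)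
  where
  nonzeroCount : ∀ c e → c ≢ 0 → signOrZero c e ≡ + 0
  nonzeroCount zero    e c≢0 = ⊥-elim (c≢0 refl)
  nonzeroCount (suc c) e _   = refl
  squareCounted : count (primeSquareDivides? (p ℕ.* m)) (suc (p ℕ.* m)) ≢ 0
  squareCounted = count-nonzero (primeSquareDivides? (p ℕ.* m)) p (suc (p ℕ.* m))
    (dec-true (prime? p ×-dec (p ℕ.* p) ∣? (p ℕ.* m)) (pp , *-monoʳ-∣ p p∣m)) (s≤s (≤-*-nonzero p m m≢0))

-- μ(p m) = - μ(m) if p ∤ m: the same square factors, and one more prime factor.
mobius-prime-mul : ∀ {p m} → Prime p → ¬ p ∣ m → m ≢ 0 → mobius (p ℕ.* m) ≡ - mobius m
mobius-prime-mul {p} {m} pp p∤m m≢0 = begin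
    mobius (p ℕ.* m)
  ≡⟨ mobius-counts (p ℕ.* m) ⟩
    signOrZero (count (primeSquareDivides? pm) (suc pm)) (count (primeDivides? pm) (suc pm))
  ≡⟨ cong₂ signOrZero sameSquares onePrimeMore ⟩
    signOrZero (count (primeSquareDivides? m) (suc m)) (suc (count (primeDivides? m) (suc m)))
  ≡⟨ flipSign (count (primeSquareDivides? m) (suc m)) (count (primeDivides? m) (suc m)) ⟩
    - signOrZero (count (primeSquareDivides? m) (suc m)) (count (primeDivides? m) (suc m))
  ≡⟨ cong -_ (sym (mobius-counts m)) ⟩
    - mobius m ∎
  where
  open ≡-Reasoning
  pm = p ℕ.* m
  m≤pm : suc m ≤ suc pm
  m≤pm = s≤s (subst (_≤ pm) (ℕP.*-identityˡ m) (ℕP.*-monoˡ-≤ m (ℕP.n≢0⇒n>0 (prime≢0 pp))))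
  flipSign : ∀ c e → signOrZero c (suc e) ≡ - signOrZero c e
  flipSign zero    e = ℤP.-1*i≡-i _
  flipSign (suc c) e = refl
  sameSquares : count (primeSquareDivides? pm) (suc pm) ≡ count (primeSquareDivides? m) (suc m)
  sameSquares = trans
    (count-cong (suc pm) (primeSquareDivides? pm) (primeSquareDivides? m) (λ q _ →
      does-⇔ (λ (pq , qq∣pm) → pq , square-∣-cancel pp pq p∤m qq∣pm) (λ (pq , qq∣m) → pq , ∣-trans qq∣m (divides p refl))
             (prime? q ×-dec (q ℕ.* q) ∣? pm) (prime? q ×-dec (q ℕ.* q) ∣? m)))
    (count-truncate (primeSquareDivides? m) (suc m) (suc pm) m≤pm (primeSquareDivides?-beyond m m≢0))
  onePrimeMore : count (primeDivides? pm) (suc pm) ≡ suc (count (primeDivides? m) (suc m))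
  onePrimeMore = trans
    (count-one-more (primeDivides? pm) (primeDivides? m) p (suc pm)
      (λ q q≢p → does-⇔ (λ (pq , q∣pm) → pq , prime-∣-cancel pp pq q≢p q∣pm) (λ (pq , q∣m) → pq , ∣-trans q∣m (divides p refl))
                        (prime? q ×-dec q ∣? pm) (prime? q ×-dec q ∣? m))
      (dec-true (prime? p ×-dec p ∣? pm) (pp , divides m (ℕP.*-comm p m)))
      (dec-false (prime? p ×-dec p ∣? m) (λ (_ , p∣m) → p∤m p∣m))
      (s≤s (≤-*-nonzero p m m≢0)))
    (cong suc (count-truncate (primeDivides? m) (suc m) (suc pm) m≤pm (primeDivides?-beyond m m≢0)))

-- The Möbius identity  Σ_{d ∣ h} μ(d) = [h = 1]

sum-multiples : ∀ p j (f : ℕ → ℤ) → p ≢ 0 → (∀ D → ¬ p ∣ D → f D ≡ + 0) →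
                sumBelow (j ℕ.* p) (f ∘ suc) ≡ sumBelow j (λ i → f (suc i ℕ.* p))
sum-multiples p j f p≢0 vanish = begin
    sumBelow (j ℕ.* p) (f ∘ suc)
  ≡⟨ sum-blocks p j (f ∘ suc) ⟩
    sumBelow j (λ i → sumBelow p (λ r → f (suc (i ℕ.* p ℕ.+ r))))
  ≡⟨ sum-cong j (λ i _ → block i) ⟩
    sumBelow j (λ i → f (suc i ℕ.* p)) ∎
  where
  open ≡-Reasoning
  suc-pred-p : suc (ℕ.pred p) ≡ p
  suc-pred-p = ℕP.suc-pred p {{ℕ.≢-nonZero p≢0}}
  -- Within the block i p + 1, …, i p + p only the last entry is a multiple of p.
  notMultiple : ∀ i r → r < p → r ≢ ℕ.pred p → ¬ p ∣ suc (i ℕ.* p ℕ.+ r)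
  notMultiple i r r<p r≢ p∣ = ℕP.<-irrefl refl (ℕP.≤-trans sr<p (∣⇒≤ (∣m+n∣m⇒∣n p∣ip+sr (divides i refl))))
    where
    sr<p : suc r < p
    sr<p = ℕP.≤∧≢⇒< r<p (λ e → r≢ (cong ℕ.pred e))
    p∣ip+sr : p ∣ i ℕ.* p ℕ.+ suc r
    p∣ip+sr = subst (p ∣_) (sym (ℕP.+-suc (i ℕ.* p) r)) p∣
  lastInBlock : ∀ i → suc (i ℕ.* p ℕ.+ ℕ.pred p) ≡ suc i ℕ.* p
  lastInBlock i = trans (sym (ℕP.+-suc (i ℕ.* p) (ℕ.pred p))) (trans (cong (i ℕ.* p ℕ.+_) suc-pred-p) (ℕP.+-comm (i ℕ.* p) p))
  block : ∀ i → sumBelow p (λ r → f (suc (i ℕ.* p ℕ.+ r))) ≡ f (suc i ℕ.* p)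
  block i = trans (sum-single p (λ r → f (suc (i ℕ.* p ℕ.+ r))) (ℕ.pred p)
                              (λ r r<p r≢ → vanish _ (notMultiple i r r<p r≢)) (subst (ℕ.pred p <_) suc-pred-p ℕP.≤-refl))
                  (cong f (lastInBlock i))

-- Σ_{d ≤ N, d ∣ h} μ(d), with d = e + 1.
divisorMobiusSum : ℕ → ℕ → ℤ
divisorMobiusSum h N = sumBelow N (λ e → if does (suc e ∣? h) then mobius (suc e) else + 0)

-- The divisors of a nonzero h are at most h.
divisorMobiusSum-truncate : ∀ h N → h ≢ 0 → h ≤ N → divisorMobiusSum h N ≡ divisorMobiusSum h h
divisorMobiusSum-truncate h N h≢0 h≤N =
  sum-truncate h N _ h≤N (λ e h≤e → if-no (suc e ∣? h) (λ e+1∣h → ℕP.<-irrefl refl (ℕP.≤-trans (s≤s h≤e) (∣⇒≤ {{ℕ.≢-nonZero h≢0}} e+1∣h))))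

-- For a prime p and h = h′ p, the divisors of h split into the divisors of h′ prime to p
-- and the multiples of p; the latter are the p E with E ∣ h′, and μ(p E) = - μ(E) or 0.
coprimeDivisorTerm : ℕ → ℕ → ℕ → ℤ
coprimeDivisorTerm p h′ e = if does (suc e ∣? h′) then (if does (p ∣? suc e) then + 0 else mobius (suc e)) else + 0

multipleDivisorTerm : ℕ → ℕ → ℕ → ℤ
multipleDivisorTerm p h D = if does (D ∣? h) then (if does (p ∣? D) then mobius D else + 0) else + 0

divisorTerm-split : ∀ {p} h h′ → Prime p → h ≡ h′ ℕ.* p → ∀ e →
                    (if does (suc e ∣? h) then mobius (suc e) else + 0) ≡ coprimeDivisorTerm p h′ e + multipleDivisorTerm p h (suc e)
divisorTerm-split {p} h h′ pp h≡h′p e = byCases (suc e ∣? h) (p ∣? suc e) (suc e ∣? h′)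
  where
  D = suc e
  h≡ph′ = trans h≡h′p (ℕP.*-comm h′ p)
  byCases : (a : Dec (D ∣ h)) (b : Dec (p ∣ D)) (c : Dec (D ∣ h′)) →
            (if does a then mobius D else + 0) ≡
            (if does c then (if does b then + 0 else mobius D) else + 0) + (if does a then (if does b then mobius D else + 0) else + 0)
  byCases (yes _)   (yes _)   (yes _)   = sym (ℤP.+-identityˡ _)
  byCases (yes _)   (yes _)   (no _)    = sym (ℤP.+-identityˡ _)
  byCases (yes _)   (no _)    (yes _)   = sym (ℤP.+-identityʳ _)
  byCases (yes D∣h) (no p∤D)  (no D∤h′) = ⊥-elim (D∤h′ (coprime-divisor (coprime-prime pp p∤D) (subst (D ∣_) h≡ph′ D∣h)))
  byCases (no D∤h)  _         (yes D∣h′) = ⊥-elim (D∤h (∣-trans D∣h′ (divides p h≡ph′)))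
  byCases (no _)    _         (no _)    = refl

multipleDivisorTerm-nonMultiple : ∀ p h D → ¬ p ∣ D → multipleDivisorTerm p h D ≡ + 0
multipleDivisorTerm-nonMultiple p h D p∤D with does (D ∣? h)
... | true  = if-no (p ∣? D) p∤D
... | false = refl

multipleDivisorTerm-multiple : ∀ {p} h h′ → Prime p → h ≡ h′ ℕ.* p → ∀ j →
                               multipleDivisorTerm p h (suc j ℕ.* p) ≡ - coprimeDivisorTerm p h′ j
multipleDivisorTerm-multiple {p} h h′ pp h≡h′p j = byCases (suc j ℕ.* p ∣? h) (p ∣? suc j ℕ.* p) (suc j ∣? h′) (p ∣? suc j)
  where
  instance _ = ℕ.≢-nonZero (prime≢0 pp)
  up : suc j ℕ.* p ∣ h → suc j ∣ h′
  up d = *-cancelˡ-∣ p (subst₂ _∣_ (ℕP.*-comm (suc j) p) (trans h≡h′p (ℕP.*-comm h′ p)) d)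
  down : suc j ∣ h′ → suc j ℕ.* p ∣ h
  down d = subst (suc j ℕ.* p ∣_) (sym h≡h′p) (*-monoˡ-∣ p d)
  reorder : mobius (suc j ℕ.* p) ≡ mobius (p ℕ.* suc j)
  reorder = cong mobius (ℕP.*-comm (suc j) p)
  byCases : (a : Dec (suc j ℕ.* p ∣ h)) (b : Dec (p ∣ suc j ℕ.* p)) (c : Dec (suc j ∣ h′)) (b′ : Dec (p ∣ suc j)) →
            (if does a then (if does b then mobius (suc j ℕ.* p) else + 0) else + 0) ≡
            - (if does c then (if does b′ then + 0 else mobius (suc j)) else + 0)
  byCases (no _)  _       (no _)  _         = refl
  byCases (no a)  _       (yes c) _         = ⊥-elim (a (down c))
  byCases (yes a) _       (no c)  _         = ⊥-elim (c (up a))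
  byCases (yes _) (no b)  (yes _) _         = ⊥-elim (b (divides (suc j) refl))
  byCases (yes _) (yes _) (yes _) (yes p∣j) = trans reorder (mobius-square pp p∣j (λ ()))
  byCases (yes _) (yes _) (yes _) (no p∤j)  = trans reorder (mobius-prime-mul pp p∤j (λ ()))

divisorMobiusSum-prime : ∀ h p → h ≢ 0 → Prime p → p ∣ h → divisorMobiusSum h h ≡ + 0
divisorMobiusSum-prime h p h≢0 pp (divides h′ h≡h′p) = begin
    divisorMobiusSum h h
  ≡⟨ sum-cong h (λ e _ → divisorTerm-split h h′ pp h≡h′p e) ⟩
    sumBelow h (λ e → U e + T (suc e))
  ≡⟨ sum-+ h U (T ∘ suc) ⟩
    sumBelow h U + sumBelow h (T ∘ suc)
  ≡⟨ cong₂ _+_ (sum-truncate h′ h U h′≤h U-beyond) multiples ⟩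
    sumBelow h′ U + - sumBelow h′ U
  ≡⟨ ℤP.+-inverseʳ (sumBelow h′ U) ⟩
    + 0 ∎
  where
  open ≡-Reasoning
  U = coprimeDivisorTerm p h′
  T = multipleDivisorTerm p h
  h′≢0 : h′ ≢ 0
  h′≢0 refl = h≢0 h≡h′p
  h′≤h : h′ ≤ h
  h′≤h = ∣⇒≤ {{ℕ.≢-nonZero h≢0}} (divides p (trans h≡h′p (ℕP.*-comm h′ p)))
  U-beyond : ∀ e → h′ ≤ e → U e ≡ + 0
  U-beyond e h′≤e = if-no (suc e ∣? h′) (λ d → ℕP.<-irrefl refl (ℕP.≤-trans (s≤s h′≤e) (∣⇒≤ {{ℕ.≢-nonZero h′≢0}} d)))
  multiples : sumBelow h (T ∘ suc) ≡ - sumBelow h′ U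
  multiples = begin
      sumBelow h (T ∘ suc)
    ≡⟨ cong (λ z → sumBelow z (T ∘ suc)) h≡h′p ⟩
      sumBelow (h′ ℕ.* p) (T ∘ suc)
    ≡⟨ sum-multiples p h′ T (prime≢0 pp) (multipleDivisorTerm-nonMultiple p h) ⟩
      sumBelow h′ (λ j → T (suc j ℕ.* p))
    ≡⟨ sum-cong h′ (λ j _ → multipleDivisorTerm-multiple h h′ pp h≡h′p j) ⟩
      sumBelow h′ (λ j → - U j)
    ≡⟨ sum-neg h′ U ⟩
      - sumBelow h′ U ∎

mobius-divisorSum : ∀ h → h ≢ 0 → (h≟1 : Dec (h ≡ 1)) → divisorMobiusSum h h ≡ (if does h≟1 then + 1 else + 0)
mobius-divisorSum h h≢0 (yes refl) = refl
mobius-divisorSum h h≢0 (no h≢1) with prime-factor h h≢0 h≢1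
... | p , pp , p∣h = divisorMobiusSum-prime h p h≢0 pp p∣h

mobius-commonDivisors : ∀ g n → g ≢ 0 →
  sumBelow g (λ e → if does (suc e ∣? g) then (if does (suc e ∣? n) then mobius (suc e) else + 0) else + 0)
  ≡ (if does (gcd n g ℕ.≟ 1) then + 1 else + 0)
mobius-commonDivisors g n g≢0 = begin
    sumBelow g (λ e → if does (suc e ∣? g) then (if does (suc e ∣? n) then mobius (suc e) else + 0) else + 0)
  ≡⟨ sum-cong g (λ e _ → commonDivisor (suc e ∣? g) (suc e ∣? n) (suc e ∣? h)) ⟩
    divisorMobiusSum h g
  ≡⟨ divisorMobiusSum-truncate h g h≢0 (∣⇒≤ {{ℕ.≢-nonZero g≢0}} (gcd[m,n]∣n n g)) ⟩
    divisorMobiusSum h h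
  ≡⟨ mobius-divisorSum h h≢0 (h ℕ.≟ 1) ⟩
    (if does (gcd n g ℕ.≟ 1) then + 1 else + 0) ∎
  where
  open ≡-Reasoning
  h = gcd n g
  h≢0 : h ≢ 0
  h≢0 e = g≢0 (gcd[m,n]≡0⇒n≡0 n e)
  commonDivisor : ∀ {D} (a : Dec (D ∣ g)) (b : Dec (D ∣ n)) (c : Dec (D ∣ h)) →
                  (if does a then (if does b then mobius D else + 0) else + 0) ≡ (if does c then mobius D else + 0)
  commonDivisor (yes _)   (yes _)   (yes _)   = refl
  commonDivisor (yes D∣g) (yes D∣n) (no D∤h)  = ⊥-elim (D∤h (gcd-greatest D∣n D∣g))
  commonDivisor (yes _)   (no D∤n)  (yes D∣h) = ⊥-elim (D∤n (∣-trans D∣h (gcd[m,n]∣m n g)))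
  commonDivisor (yes _)   (no _)    (no _)    = refl
  commonDivisor (no D∤g)  _         (yes D∣h) = ⊥-elim (D∤g (∣-trans D∣h (gcd[m,n]∣n n g)))
  commonDivisor (no _)    _         (no _)    = refl

gcdVec-divides : ∀ {j} (ν : Vec ℕ j) → VecAll.All (gcdVec ν ∣_) ν
gcdVec-divides Vec.[]       = []
gcdVec-divides (a Vec.∷ ν) = gcd[m,n]∣m a (gcdVec ν) ∷ VecAll.map (∣-trans (gcd[m,n]∣n a (gcdVec ν))) (gcdVec-divides ν)

gcdVec-nonzero : ∀ {j} {ν : Vec ℕ (suc j)} → Partition ν → gcdVec ν ≢ 0
gcdVec-nonzero (single {a} a≥1) g≡0 with gcd[m,n]≡0⇒m≡0 {a} g≡0
... | refl with a≥1
... | ()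
gcdVec-nonzero (cons {a = a} _ p) g≡0 = gcdVec-nonzero p (gcd[m,n]≡0⇒n≡0 a g≡0)

select-* : ∀ (b : Bool) x y → x * (if b then y else + 0) ≡ (if b then x else + 0) * y
select-* true  x y = refl
select-* false x y = ℤP.*-zeroʳ x

indicator-* : ∀ (b : Bool) y → (if b then + 1 else + 0) * y ≡ (if b then y else + 0)
indicator-* true  y = ℤP.*-identityˡ y
indicator-* false y = refl

-- By dilation, the d-th summand of the right hand side is μ(d) [d ∣ g] [d ∣ n] F_ν(n).
divisorSummand : ∀ {k} (ν : Vec ℕ (suc k)) n e →
  (if does (suc e ∣? gcdVec ν)
   then scale (mobius (suc e) ℤ.* (+ suc e) ℤ.^ k)
              (substPow (suc e) (tSer ⊛ (eulerian k ⊛ prodVec (Vec.map (λ a → qInt (a / suc e)) ν)))) n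
   else + 0)
  ≡ (if does (suc e ∣? gcdVec ν) then (if does (suc e ∣? n) then mobius (suc e) else + 0) else + 0) * Fser ν n
divisorSummand {k} ν n e = byDivisibility (suc e ∣? gcdVec ν)
  where
  H = substPow (suc e) (tSer ⊛ (eulerian k ⊛ prodVec (Vec.map (λ a → qInt (a / suc e)) ν)))
  byDivisibility : (e∣?g : Dec (suc e ∣ gcdVec ν)) →
    (if does e∣?g then (mobius (suc e) ℤ.* (+ suc e) ℤ.^ k) * H n else + 0)
    ≡ (if does e∣?g then (if does (suc e ∣? n) then mobius (suc e) else + 0) else + 0) * Fser ν n
  byDivisibility (no _)    = refl
  byDivisibility (yes e∣g) = begin
      mobius (suc e) ℤ.* (+ suc e) ℤ.^ k * H n
    ≡⟨ ℤP.*-assoc (mobius (suc e)) _ _ ⟩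
      mobius (suc e) * ((+ suc e) ℤ.^ k * H n)
    ≡⟨ cong (mobius (suc e) *_) (dilation ν e (VecAll.map (∣-trans e∣g) (gcdVec-divides ν)) n) ⟩
      mobius (suc e) * (if does (suc e ∣? n) then Fser ν n else + 0)
    ≡⟨ select-* (does (suc e ∣? n)) (mobius (suc e)) (Fser ν n) ⟩
      (if does (suc e ∣? n) then mobius (suc e) else + 0) * Fser ν n ∎
    where open ≡-Reasoning

lemma4p2 : (k : ℕ) (ν : Vec ℕ (suc k)) → Partition ν →
    (n : ℕ) → G ν n ≡ RHS ν n
lemma4p2 k ν partition n = sym (begin
    RHS ν n
  ≡⟨ sum-cong g (λ e _ → divisorSummand ν n e) ⟩
    sumBelow g (λ e → μ[e+1∣g,n] e * Fser ν n)
  ≡⟨ sum-*ʳ g μ[e+1∣g,n] (Fser ν n) ⟩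
    sumBelow g μ[e+1∣g,n] * Fser ν n
  ≡⟨ cong (_* Fser ν n) (mobius-commonDivisors g n (gcdVec-nonzero partition)) ⟩
    (if does (gcd n g ℕ.≟ 1) then + 1 else + 0) * Fser ν n
  ≡⟨ indicator-* (does (gcd n g ℕ.≟ 1)) (Fser ν n) ⟩
    G ν n ∎)
  where
  open ≡-Reasoning
  g = gcdVec ν
  μ[e+1∣g,n] : ℕ → ℤ
  μ[e+1∣g,n] e = if does (suc e ∣? g) then (if does (suc e ∣? n) then mobius (suc e) else + 0) else + 0
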